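{- Let $d$ be a power of $2$. For any $\varepsilon>0$ there is $n_0(\varepsilon)\in\mathbb{N}$ such that for every $n\ge n_0(\varepsilon)$ and every $\Phi=(\Phi_1,\Phi_2)$, $\Psi=(\Psi_1,\Psi_2)$ with $\Phi_1,\Phi_2\in\mathbb{F}_2[x_1,\dots,x_n]$ $d$-simple w.r.t. $x$ and $\Psi_1,\Psi_2\in\mathbb{F}_2[y_1,\dots,y_n]$ $d$-simple w.r.t. $y$, if $H:\{0,1\}^{2n}\to\{0,1\}$ is chosen uniformly at random then $\Pr_H[H \text{ is not } \varepsilon\text{ -hard}]\le\varepsilon$.
   Context: Polynomials are multilinear over $\mathbb{F}_2$ in $x_1,\dots,x_n,y_1,\dots,y_n$. $S_t(x)=\binom{|x|}{t}\bmod 2$ is the elementary symmetric polynomial of degree $t$ in the $x$-variables ($|x|$ the Hamming weight), similarly $S_t(y)$. $\Phi\in\mathbb{F}_2[x_1,\dots,x_n]$ is $d$-simple w.r.t. $x$ if it is an $\mathbb{F}_2$-linear combination of $S_t(x)$, $t<d$ (similarly for $y$). Let $S_{\Phi,\Psi}=\{(x,y): S_d(x)=1\oplus\Phi_1(x),\ S_d(y)=1\oplus\Psi_1(y)\}$ and $\mathrm{agr}_S(H,Q')=\Pr_{(x,y)\in S_{\Phi,\Psi}}[H(x,y)=Q'(x,y)]$ (uniform over $S_{\Phi,\Psi}$). $H$ is $\varepsilon$-hard if for every $Q'\in\mathbb{F}_2[x_1,\dots,x_n,y_1,\dots,y_n]$ of degree at most $3d-1$, $|\mathrm{agr}_S(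H,Q')-\frac12|\le\varepsilon$.
   Formalization: The parameter ε ranges over the positive rationals. -}

module Defs where

open import Data.Bool using (Bool; true; false; _∧_; _xor_; if_then_else_; T)
open import Data.Nat using (ℕ; zero; suc; _+_; _*_; _∸_; _^_; _≤_; _%_; _≡ᵇ_)
open import Data.Nat.Combinatorics using (_C_)
open import Data.Fin using (Fin)
open import Data.Vec using (Vec; []; _∷_; _++_; lookup)
open import Data.List using (List; []; _∷_; map; concatMap; foldr; length; filter)
open import Data.List using (allFin)
open import Data.Product using (Σ; ∃; _×_; _,_)
open import Relation.Binary.PropositionalEquality using (_≡_)
open import Data.Integer using (+_)
open import Data.Rational using (ℚ; _/_; _-_; ∣_∣)
import Data.Rational as Q
open import Relation.Nullary.Decidable using (does)
open import Data.Bool.Properties using (_≟_)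

BVec : ℕ → Set
BVec m = Vec Bool m

allVecs : (m : ℕ) → List (BVec m)
allVecs zero    = [] ∷ []
allVecs (suc m) = concatMap (λ v → (false ∷ v) ∷ (true ∷ v) ∷ []) (allVecs m)

weight : ∀ {m} → BVec m → ℕ
weight []           = 0
weight (false ∷ v)  = weight v
weight (true ∷ v)   = suc (weight v)

xorSum : ∀ {A : Set} → (A → Bool) → List A → Bool
xorSum f = foldr (λ a b → f a xor b) false

countB : ∀ {A : Set} → (A → Bool) → List A → ℕ
countB f xs = foldr (λ a k → if f a then suc k else k) 0 xs

-- A multilinear polynomial over F₂ in m variables, given by its
-- coefficient function on monomials; a monomial ∏_{i∈U} z_i is
-- encoded by the indicator vector of U.
Poly : ℕ → Set
Poly m = BVec m → Bool

monomial : ∀ {m} → BVec m → BVec m → Bool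
monomial []             []        = true
monomial (false ∷ mono) (_ ∷ a)   = monomial mono a
monomial (true ∷ mono)  (b ∷ a)   = b ∧ monomial mono a

eval : ∀ {m} → Poly m → BVec m → Bool
eval {m} p a = xorSum (λ mono → p mono ∧ monomial mono a) (allVecs m)

DegLe : ∀ {m} → Poly m → ℕ → Set
DegLe p k = ∀ mono → p mono ≡ true → weight mono ≤ k

oddᵇ : ℕ → Bool
oddᵇ k = (k % 2) ≡ᵇ 1

-- S_t(x) = binom(|x|, t) mod 2 (elementary symmetric polynomial of degree t).
Sym : ∀ {n} → ℕ → BVec n → Bool
Sym t x = oddᵇ (weight x C t)

-- Φ ∈ F₂[x₁..xₙ] is d-simple: an F₂-linear combination of S_t, t < d.
-- (Equality of multilinear polynomials = equality of their evaluations.)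
DSimple : ∀ {n} → ℕ → Poly n → Set
DSimple {n} d Φ = Σ (Fin d → Bool) λ c →
  ∀ (x : BVec n) → eval Φ x ≡ xorSum (λ t → c t ∧ Sym (Data.Fin.toℕ t) x) (allFin d)

PowerOf2 : ℕ → Set
PowerOf2 d = ∃ λ k → d ≡ 2 ^ k

allPairs : (n : ℕ) → List (BVec n × BVec n)
allPairs n = concatMap (λ x → map (λ y → (x , y)) (allVecs n)) (allVecs n)

inS : ∀ {n} → ℕ → Poly n → Poly n → BVec n × BVec n → Bool
inS d Φ₁ Ψ₁ (x , y) =
  does (Sym d x ≟ (true xor eval Φ₁ x)) ∧ does (Sym d y ≟ (true xor eval Ψ₁ y))

filterB : ∀ {A : Set} → (A → Bool) → List A → List A
filterB f = foldr (λ a xs → if f a then a ∷ xs else xs) []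

toℚ : ℕ → ℚ
toℚ k = (+ k) / 1

BoolFun : ℕ → Set
BoolFun n = BVec n → BVec n → Bool

-- H is ε-hard (w.r.t. d, Φ₁, Ψ₁): for every Q' of degree ≤ 3d-1 in the 2n
-- variables (x then y), |agr_S(H,Q') - 1/2| ≤ ε, where agr_S = A/|S| with
-- A = #{(x,y) ∈ S : H(x,y) = Q'(x,y)}.  Stated multiplied through by 2|S|:
-- |2A - |S|| ≤ 2ε|S|  (identical for S ≠ ∅; S is nonempty for n ≥ d).
Hard : ∀ {n} → ℕ → Poly n → Poly n → ℚ → BoolFun n → Set
Hard {n} d Φ₁ Ψ₁ ε H =
  ∀ (Q' : Poly (n + n)) → DegLe Q' (3 * d ∸ 1) →
    let S = filterB (inS d Φ₁ Ψ₁) (allPairs n)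
        sz = length S
        A = countB (λ { (x , y) → does (H x y ≟ eval Q' (x ++ y)) }) S
    in Q._≤_ ∣ toℚ (2 * A) - toℚ sz ∣ (toℚ 2 Q.* ε Q.* toℚ sz)

module Submission where

-- If H is not ε-hard, some Q′ of degree < 3d agrees with H on more than (1/2 + ε)|S| or fewer than
-- (1/2 − ε)|S| points of S, so with K ≥ 1/ε one colour class of the error function g = H ⊕ Q′ on S has
-- more than (1/2 + 1/K)|S| points. Thus H = g ⊕ Q′, where Q′ is one of 2^N polynomials on the
-- N ≤ (2n+1)^(3d−1) monomials of degree < 3d and g is unbalanced on S. Expanding
--   Σ_g (K+1)^#{S ∧ ¬g} K^#{S ∧ g} = 2^(2^(2n) − |S|) (2K+1)^|S|
-- gives a Chernoff bound: unbalanced g form a fraction of all g that is exponentially small in |S|.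
-- And |S| ≥ 4^(n−d): flipping the first d = 2^j coordinates of x from 0 to 1 preserves S_t(x) for t < d,
-- hence Φ₁(x), but flips S_d(x) (Lucas), so one of the two points lies in the x-slice of S, and likewise
-- for y. For large n this beats 2^N, leaving at most 2^(2^(2n))/K ≤ ε 2^(2^(2n)) non-hard H.

open import Defs

module RationalBounds where

  open import Data.Nat as ℕ using (ℕ; suc)
  import Data.Nat.Properties as ℕ
  open import Data.Nat.Coprimality as Coprime using (1-coprimeTo)
  open import Data.Nat.Tactic.RingSolver using (solve-∀)
  open import Data.Integer as ℤ using (+_; +[1+_])
  import Data.Integer.Properties as ℤ
  open import Data.Rational
  open import Data.Rational.Properties
  import Data.Rational.Unnormalised as ℚᵘ
  import Data.Rational.Unnormalised.Properties as ℚᵘ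
  open import Data.Rational.Solver using (module +-*-Solver)
  open +-*-Solver using (solve; _:+_; _:*_; _:-_; :-_; _:=_)
  open import Data.Sum using (inj₁; inj₂)
  open import Relation.Binary.PropositionalEquality

  -- The normal form of toℚ k, on which ℕ-arithmetic is computed definitionally.
  fromℕ : ℕ → ℚ
  fromℕ k = mkℚ (+ k) 0 (Coprime.sym (1-coprimeTo k))

  toℚ≡fromℕ : ∀ k → toℚ k ≡ fromℕ k
  toℚ≡fromℕ k = normalize-coprime (Coprime.sym (1-coprimeTo k))

  fromℕ-+ : ∀ a b → fromℕ (a ℕ.+ b) ≡ fromℕ a + fromℕ b
  fromℕ-+ a b = trans (sym (toℚ≡fromℕ (a ℕ.+ b)))
    (cong (_/ 1) (trans (ℤ.pos-+ a b) (sym (cong₂ ℤ._+_ (ℤ.*-identityʳ (+ a)) (ℤ.*-identityʳ (+ b))))))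

  fromℕ-* : ∀ a b → fromℕ (a ℕ.* b) ≡ fromℕ a * fromℕ b
  fromℕ-* a b = trans (sym (toℚ≡fromℕ (a ℕ.* b))) (cong (_/ 1) (ℤ.pos-* a b))

  fromℕ-mono-≤ : ∀ {a b} → a ℕ.≤ b → fromℕ a ≤ fromℕ b
  fromℕ-mono-≤ {a} {b} a≤b = *≤* (subst₂ ℤ._≤_ (sym (ℤ.*-identityʳ (+ a))) (sym (ℤ.*-identityʳ (+ b))) (ℤ.+≤+ a≤b))

  1≤ε*[1+↧ε] : ∀ ε → Positive ε → fromℕ 1 ≤ ε * fromℕ (suc (↧ₙ ε))
  1≤ε*[1+↧ε] ε@(mkℚ +[1+ a ] b _) _ =
    toℚᵘ-cancel-≤ (ℚᵘ.≤-respʳ-≃ (ℚᵘ.≃-sym (toℚᵘ-homo-* ε (fromℕ (suc (suc b)))))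
      (ℚᵘ.*≤* (ℤ.+≤+ (ℕ.s≤s (subst₂ ℕ._≤_ (sym (lhs b)) (sym (rhs a b)) (ℕ.m≤n⇒m≤1+n (ℕ.m≤m+n b (a ℕ.* suc (suc b)))))))))
    where
    lhs : ∀ b → b ℕ.* 1 ℕ.+ 0 ℕ.* suc (b ℕ.* 1) ≡ b
    lhs = solve-∀
    rhs : ∀ a b → suc ((b ℕ.+ a ℕ.* suc (suc b)) ℕ.* 1) ≡ suc (b ℕ.+ a ℕ.* suc (suc b))
    rhs = solve-∀

  ∣∣-≤ : ∀ {x e} → x ≤ e → - x ≤ e → ∣ x ∣ ≤ e
  ∣∣-≤ {x} {e} x≤e -x≤e with ∣p∣≡p∨∣p∣≡-p x
  ... | inj₁ ∣x∣≡x  = subst (_≤ e) (sym ∣x∣≡x) x≤e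
  ... | inj₂ ∣x∣≡-x = subst (_≤ e) (sym ∣x∣≡-x) -x≤e

  module _ (ε : ℚ) .{{_ : NonNegative ε}} (k : ℕ) (1≤εK : fromℕ 1 ≤ ε * fromℕ (suc k)) where

    private K = suc k

    ≤⇒≤ε* : ∀ {X Y} → K ℕ.* X ℕ.≤ Y → toℚ X ≤ ε * toℚ Y
    ≤⇒≤ε* {X} {Y} KX≤Y rewrite toℚ≡fromℕ X | toℚ≡fromℕ Y = begin
      fromℕ X                   ≡⟨ sym (*-identityʳ (fromℕ X)) ⟩
      fromℕ X * fromℕ 1         ≤⟨ *-monoˡ-≤-nonNeg (fromℕ X) 1≤εK ⟩
      fromℕ X * (ε * fromℕ K)   ≡⟨ solve 3 (λ x e k → x :* (e :* k) := e :* (k :* x)) refl (fromℕ X) ε (fromℕ K) ⟩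
      ε * (fromℕ K * fromℕ X)   ≡⟨ cong (ε *_) (sym (fromℕ-* K X)) ⟩
      ε * fromℕ (K ℕ.* X)       ≤⟨ *-monoˡ-≤-nonNeg ε (fromℕ-mono-≤ KX≤Y) ⟩
      ε * fromℕ Y               ∎
      where open ≤-Reasoning

    ≤+⇒-≤ε* : ∀ a b c → K ℕ.* a ℕ.≤ K ℕ.* b ℕ.+ 2 ℕ.* c → fromℕ a - fromℕ b ≤ fromℕ 2 * ε * fromℕ c
    ≤+⇒-≤ε* a b c Ka≤Kb+2c = *-cancelˡ-≤-pos (fromℕ K) (begin
      κ * (fromℕ a - fromℕ b)         ≡⟨ solve 3 (λ x y z → x :* (y :- z) := x :* y :- x :* z) refl κ (fromℕ a) (fromℕ b) ⟩
      κ * fromℕ a - κ * fromℕ b       ≤⟨ -≤ (subst₂ _≤_ (fromℕ-* K a) (trans (fromℕ-+ (K ℕ.* b) (2 ℕ.* c)) (cong₂ _+_ (fromℕ-* K b) (fromℕ-* 2 c))) (fromℕ-mono-≤ Ka≤Kb+2c)) ⟩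
      fromℕ 2 * fromℕ c               ≡⟨ sym (*-identityʳ (fromℕ 2 * fromℕ c)) ⟩
      fromℕ 2 * fromℕ c * fromℕ 1     ≤⟨ subst (λ z → z * fromℕ 1 ≤ z * (ε * κ)) (fromℕ-* 2 c) (*-monoˡ-≤-nonNeg (fromℕ (2 ℕ.* c)) 1≤εK) ⟩
      fromℕ 2 * fromℕ c * (ε * κ)     ≡⟨ solve 4 (λ t c e k → t :* c :* (e :* k) := k :* (t :* e :* c)) refl (fromℕ 2) (fromℕ c) ε κ ⟩
      κ * (fromℕ 2 * ε * fromℕ c)     ∎)
      where
      open ≤-Reasoning
      κ = fromℕ K
      -≤ : ∀ {x y z} → x ≤ y + z → x - y ≤ z
      -≤ {x} {y} {z} x≤y+z = ≤-trans (+-monoˡ-≤ (- y) x≤y+z) (≤-reflexive (solve 2 (λ y z → (y :+ z) :- y := z) refl y z))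

    ∣2Z-M∣≤2εM : ∀ Z Y M → Z ℕ.+ Y ≡ M → 2 ℕ.* K ℕ.* Z ℕ.≤ (K ℕ.+ 2) ℕ.* M → 2 ℕ.* K ℕ.* Y ℕ.≤ (K ℕ.+ 2) ℕ.* M →
                 ∣ toℚ (2 ℕ.* Z) - toℚ M ∣ ≤ toℚ 2 * ε * toℚ M
    ∣2Z-M∣≤2εM Z Y M Z+Y≡M Z-bound Y-bound rewrite toℚ≡fromℕ (2 ℕ.* Z) | toℚ≡fromℕ M | toℚ≡fromℕ 2 =
      ∣∣-≤ (≤+⇒-≤ε* (2 ℕ.* Z) M M upper) (subst (_≤ fromℕ 2 * ε * fromℕ M) flip (≤+⇒-≤ε* M (2 ℕ.* Z) M lower))
      where
      flip : fromℕ M - fromℕ (2 ℕ.* Z) ≡ - (fromℕ (2 ℕ.* Z) - fromℕ M)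
      flip = solve 2 (λ x y → y :- x := :- (x :- y)) refl (fromℕ (2 ℕ.* Z)) (fromℕ M)
      [K+2]M≡ : ∀ K M → (K ℕ.+ 2) ℕ.* M ≡ K ℕ.* M ℕ.+ 2 ℕ.* M
      [K+2]M≡ = solve-∀
      upper : K ℕ.* (2 ℕ.* Z) ℕ.≤ K ℕ.* M ℕ.+ 2 ℕ.* M
      upper = subst₂ ℕ._≤_ (twice K Z) ([K+2]M≡ K M) Z-bound
        where twice : ∀ K Z → 2 ℕ.* K ℕ.* Z ≡ K ℕ.* (2 ℕ.* Z)
              twice = solve-∀
      -- Since Z + Y = M, the bound on Y is a lower bound on Z.
      lower : K ℕ.* M ℕ.≤ K ℕ.* (2 ℕ.* Z) ℕ.+ 2 ℕ.* M
      lower = ℕ.+-cancelʳ-≤ (K ℕ.* M) _ _ (begin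
        K ℕ.* M ℕ.+ K ℕ.* M                                ≡⟨ cong (λ m → K ℕ.* m ℕ.+ K ℕ.* m) (sym Z+Y≡M) ⟩
        K ℕ.* (Z ℕ.+ Y) ℕ.+ K ℕ.* (Z ℕ.+ Y)                ≡⟨ expand K Z Y ⟩
        K ℕ.* (2 ℕ.* Z) ℕ.+ 2 ℕ.* K ℕ.* Y                  ≤⟨ ℕ.+-monoʳ-≤ (K ℕ.* (2 ℕ.* Z)) (subst (2 ℕ.* K ℕ.* Y ℕ.≤_) ([K+2]M≡ K M) Y-bound) ⟩
        K ℕ.* (2 ℕ.* Z) ℕ.+ (K ℕ.* M ℕ.+ 2 ℕ.* M)          ≡⟨ rotate (K ℕ.* (2 ℕ.* Z)) (K ℕ.* M) (2 ℕ.* M) ⟩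
        K ℕ.* (2 ℕ.* Z) ℕ.+ 2 ℕ.* M ℕ.+ K ℕ.* M            ∎)
        where
        open ℕ.≤-Reasoning
        rotate : ∀ a b c → a ℕ.+ (b ℕ.+ c) ≡ a ℕ.+ c ℕ.+ b
        rotate = solve-∀
        expand : ∀ K Z Y → K ℕ.* (Z ℕ.+ Y) ℕ.+ K ℕ.* (Z ℕ.+ Y) ≡ K ℕ.* (2 ℕ.* Z) ℕ.+ 2 ℕ.* K ℕ.* Y
        expand = solve-∀

module Lemmas where

  open import Data.Bool using (Bool; true; false; _∧_; _∨_; _xor_; not)
  open import Data.Bool.Properties
    using (_≟_; ∧-identityʳ; not-involutive; not-distribˡ-xor; xor-assoc; xor-comm; xor-same; xor-identityʳ; true-xor)
  open import Data.Fin using (toℕ)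
  open import Data.Fin.Properties using (toℕ<n)
  open import Data.List using (List; []; _∷_; map; concatMap; length; allFin) renaming (_++_ to _++ᴸ_)
  open import Data.List.Extrema.Nat using (argmin; argmin-all; f[argmin]≤f[⊤]; f[argmin]≤f[xs])
  open import Data.List.Membership.Propositional using (_∈_; find; lose)
  open import Data.List.Membership.Propositional.Properties using (∈-++⁺ˡ; ∈-++⁺ʳ; ∈-map⁺)
  open import Data.List.Relation.Unary.All as All using (All; []; _∷_; all?)
  open import Data.List.Relation.Unary.All.Properties using (¬All⇒Any¬)
  open import Data.List.Relation.Unary.Any using (Any; here; there)
  open import Data.Nat using (ℕ; zero; suc; _≡ᵇ_; _+_; _*_; _∸_; _^_; _≤_; _<_; z≤n; s≤s; NonZero)
  open import Data.Nat.Combinatorics using (_C_; nCk+nC[k+1]≡[n+1]C[k+1])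
  open import Data.Nat.DivMod using (_%_; [m+n]%n≡m%n)
  open import Data.Nat.Properties hiding (_≟_)
  open import Data.Nat.Tactic.RingSolver using (solve-∀)
  open import Data.Product using (Σ; _×_; _,_; proj₁; proj₂)
  open import Data.Rational using (ℚ; NonNegative)
  import Data.Rational as ℚ
  open import Data.Vec using ([]; _∷_; _++_; replicate)
  open import Data.Vec.Properties using (≡-dec)
  open import Relation.Binary.Definitions using (DecidableEquality)
  open import Relation.Binary.PropositionalEquality
  open import Relation.Nullary using (Dec; yes; no; ¬_; contradiction)
  open import Relation.Nullary.Decidable using (does; dec-true)
  open RationalBounds using (fromℕ; ∣2Z-M∣≤2εM; ≤⇒≤ε*)

  private variable
    A B : Set
    m : ℕ

  𝟙 : Bool → ℕ
  𝟙 true  = 1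
  𝟙 false = 0

  𝟙-∧ : ∀ a b → 𝟙 (a ∧ b) ≡ 𝟙 a * 𝟙 b
  𝟙-∧ true  b = sym (+-identityʳ (𝟙 b))
  𝟙-∧ false b = refl

  ^-distribʳ-* : ∀ a b k → (a * b) ^ k ≡ a ^ k * b ^ k
  ^-distribʳ-* a b zero    = refl
  ^-distribʳ-* a b (suc k) rewrite ^-distribʳ-* a b k = interchange a b (a ^ k) (b ^ k)
    where interchange : ∀ a b c d → a * b * (c * d) ≡ a * c * (b * d)
          interchange = solve-∀

  sumBy : (A → ℕ) → List A → ℕ
  sumBy f []       = 0
  sumBy f (a ∷ as) = f a + sumBy f as

  syntax sumBy (λ x → e) xs = ∑[ x ∈ xs ] e

  sumBy-cong : {f g : A → ℕ} → (∀ a → f a ≡ g a) → ∀ xs → sumBy f xs ≡ sumBy g xs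
  sumBy-cong f≡g []       = refl
  sumBy-cong f≡g (a ∷ as) = cong₂ _+_ (f≡g a) (sumBy-cong f≡g as)

  sumBy-mono : {f g : A → ℕ} → (∀ a → f a ≤ g a) → ∀ xs → sumBy f xs ≤ sumBy g xs
  sumBy-mono f≤g []       = z≤n
  sumBy-mono f≤g (a ∷ as) = +-mono-≤ (f≤g a) (sumBy-mono f≤g as)

  sumBy-++ : (f : A → ℕ) (xs ys : List A) → sumBy f (xs ++ᴸ ys) ≡ sumBy f xs + sumBy f ys
  sumBy-++ f []       ys = refl
  sumBy-++ f (a ∷ as) ys = trans (cong (f a +_) (sumBy-++ f as ys)) (sym (+-assoc (f a) _ _))

  sumBy-concatMap : (f : B → ℕ) (g : A → List B) (xs : List A) →
                    sumBy f (concatMap g xs) ≡ ∑[ a ∈ xs ] sumBy f (g a)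
  sumBy-concatMap f g []       = refl
  sumBy-concatMap f g (a ∷ as) =
    trans (sumBy-++ f (g a) (concatMap g as)) (cong (sumBy f (g a) +_) (sumBy-concatMap f g as))

  sumBy-map : (f : B → ℕ) (g : A → B) (xs : List A) → sumBy f (map g xs) ≡ ∑[ a ∈ xs ] f (g a)
  sumBy-map f g []       = refl
  sumBy-map f g (a ∷ as) = cong (f (g a) +_) (sumBy-map f g as)

  sumBy-+ : (f g : A → ℕ) (xs : List A) → ∑[ a ∈ xs ] (f a + g a) ≡ sumBy f xs + sumBy g xs
  sumBy-+ f g []       = refl
  sumBy-+ f g (a ∷ as) rewrite sumBy-+ f g as = shuffle (f a) (g a) (sumBy f as) (sumBy g as)
    where shuffle : ∀ a b c d → a + b + (c + d) ≡ a + c + (b + d)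
          shuffle = solve-∀

  sumBy-*ˡ : (c : ℕ) (f : A → ℕ) (xs : List A) → ∑[ a ∈ xs ] (c * f a) ≡ c * sumBy f xs
  sumBy-*ˡ c f []       = sym (*-zeroʳ c)
  sumBy-*ˡ c f (a ∷ as) rewrite sumBy-*ˡ c f as = sym (*-distribˡ-+ c (f a) _)

  sumBy-const : (c : ℕ) (xs : List A) → ∑[ _ ∈ xs ] c ≡ c * length xs
  sumBy-const c []       = sym (*-zeroʳ c)
  sumBy-const c (a ∷ as) rewrite sumBy-const c as = sym (*-suc c (length as))

  length≡sumBy-1 : (xs : List A) → length xs ≡ ∑[ _ ∈ xs ] 1
  length≡sumBy-1 xs = sym (trans (sumBy-const 1 xs) (*-identityˡ (length xs)))

  sumBy-product : (f : A → ℕ) (g : B → ℕ) (xs : List A) (ys : List B) →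
                  ∑[ a ∈ xs ] ∑[ b ∈ ys ] (f a * g b) ≡ sumBy f xs * sumBy g ys
  sumBy-product f g []       ys = refl
  sumBy-product f g (a ∷ as) ys rewrite sumBy-*ˡ (f a) g ys | sumBy-product f g as ys =
    sym (*-distribʳ-+ (sumBy g ys) (f a) _)

  ∈⇒≤sumBy : (f : A → ℕ) {a : A} (xs : List A) → a ∈ xs → f a ≤ sumBy f xs
  ∈⇒≤sumBy f (x ∷ xs) (here refl) = m≤m+n (f x) _
  ∈⇒≤sumBy f (x ∷ xs) (there a∈)  = ≤-trans (∈⇒≤sumBy f xs a∈) (m≤n+m _ (f x))

  ∈-concatMap⁺ : (g : A → List B) {a : A} {b : B} (xs : List A) → a ∈ xs → b ∈ g a → b ∈ concatMap g xs
  ∈-concatMap⁺ g (x ∷ xs) (here refl) b∈ = ∈-++⁺ˡ b∈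
  ∈-concatMap⁺ g (x ∷ xs) (there a∈)  b∈ = ∈-++⁺ʳ (g x) (∈-concatMap⁺ g xs a∈ b∈)

  length-filterB : (s : A → Bool) (xs : List A) → length (filterB s xs) ≡ ∑[ a ∈ xs ] 𝟙 (s a)
  length-filterB s []       = refl
  length-filterB s (a ∷ as) with s a
  ... | true  = cong suc (length-filterB s as)
  ... | false = length-filterB s as

  countB-filterB : (s p : A → Bool) (xs : List A) → countB p (filterB s xs) ≡ ∑[ a ∈ xs ] 𝟙 (s a ∧ p a)
  countB-filterB s p []       = refl
  countB-filterB s p (a ∷ as) with s a
  ... | false = countB-filterB s p as
  ... | true with p a
  ...   | true  = cong suc (countB-filterB s p as)
  ...   | false = countB-filterB s p as

  sumBy-filterB≤ : (s : A → Bool) (f : A → ℕ) (xs : List A) → sumBy f (filterB s xs) ≤ sumBy f xs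
  sumBy-filterB≤ s f []       = z≤n
  sumBy-filterB≤ s f (a ∷ as) with s a
  ... | true  = +-monoʳ-≤ (f a) (sumBy-filterB≤ s f as)
  ... | false = ≤-trans (sumBy-filterB≤ s f as) (m≤n+m _ (f a))

  ∈-filterB⁺ : (s : A → Bool) {a : A} (xs : List A) → a ∈ xs → s a ≡ true → a ∈ filterB s xs
  ∈-filterB⁺ s (x ∷ xs) (here refl) sa rewrite sa = here refl
  ∈-filterB⁺ s (x ∷ xs) (there a∈)  sa with s x
  ... | true  = there (∈-filterB⁺ s xs a∈ sa)
  ... | false = ∈-filterB⁺ s xs a∈ sa

  ∈-filterB⁻ : (s : A → Bool) {a : A} (xs : List A) → a ∈ filterB s xs → s a ≡ true
  ∈-filterB⁻ s (x ∷ xs) a∈ with s x in sx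
  ∈-filterB⁻ s (x ∷ xs) (here refl) | true = sx
  ∈-filterB⁻ s (x ∷ xs) (there a∈)  | true = ∈-filterB⁻ s xs a∈
  ... | false = ∈-filterB⁻ s xs a∈

  sumBy-allVecs-suc : ∀ m (f : BVec (suc m) → ℕ) →
    sumBy f (allVecs (suc m)) ≡ ∑[ v ∈ allVecs m ] f (false ∷ v) + ∑[ v ∈ allVecs m ] f (true ∷ v)
  sumBy-allVecs-suc m f =
    trans (sumBy-concatMap f _ (allVecs m))
          (trans (sumBy-cong (λ v → cong (f (false ∷ v) +_) (+-identityʳ _)) (allVecs m))
                 (sumBy-+ _ _ (allVecs m)))

  sumBy-allVecs-++ : ∀ a b (f : BVec (a + b) → ℕ) →
    sumBy f (allVecs (a + b)) ≡ ∑[ u ∈ allVecs a ] ∑[ v ∈ allVecs b ] f (u ++ v)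
  sumBy-allVecs-++ zero    b f = sym (+-identityʳ _)
  sumBy-allVecs-++ (suc a) b f = begin
    sumBy f (allVecs (suc (a + b)))
      ≡⟨ sumBy-allVecs-suc (a + b) f ⟩
    ∑[ v ∈ allVecs (a + b) ] f (false ∷ v) + ∑[ v ∈ allVecs (a + b) ] f (true ∷ v)
      ≡⟨ cong₂ _+_ (sumBy-allVecs-++ a b (λ v → f (false ∷ v))) (sumBy-allVecs-++ a b (λ v → f (true ∷ v))) ⟩
    ∑[ u ∈ allVecs a ] ∑[ v ∈ allVecs b ] f (false ∷ u ++ v) + ∑[ u ∈ allVecs a ] ∑[ v ∈ allVecs b ] f (true ∷ u ++ v)
      ≡⟨ sym (sumBy-allVecs-suc a (λ u → ∑[ v ∈ allVecs b ] f (u ++ v))) ⟩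
    ∑[ u ∈ allVecs (suc a) ] ∑[ v ∈ allVecs b ] f (u ++ v) ∎
    where open ≡-Reasoning

  length-allVecs : ∀ m → length (allVecs m) ≡ 2 ^ m
  length-allVecs m = trans (length≡sumBy-1 (allVecs m)) (count m)
    where
    count : ∀ m → ∑[ _ ∈ allVecs m ] 1 ≡ 2 ^ m
    count zero    = refl
    count (suc m) rewrite sumBy-allVecs-suc m (λ _ → 1) | count m = cong (2 ^ m +_) (sym (+-identityʳ _))

  ∈-allVecs : ∀ {m} (v : BVec m) → v ∈ allVecs m
  ∈-allVecs []          = here refl
  ∈-allVecs (false ∷ v) = ∈-concatMap⁺ _ _ (∈-allVecs v) (here refl)
  ∈-allVecs (true ∷ v)  = ∈-concatMap⁺ _ _ (∈-allVecs v) (there (here refl))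

  splitAt : ∀ a {b} → BVec (a + b) → BVec a × BVec b
  splitAt zero    v       = [] , v
  splitAt (suc a) (x ∷ v) with splitAt a v
  ... | u , w = x ∷ u , w

  splitAt-++ : ∀ a {b} (x : BVec a) (y : BVec b) → splitAt a (x ++ y) ≡ (x , y)
  splitAt-++ zero    []      y = refl
  splitAt-++ (suc a) (b ∷ x) y rewrite splitAt-++ a x y = refl

  sumBy-allPairs : ∀ n (f : BVec n × BVec n → ℕ) →
    sumBy f (allPairs n) ≡ ∑[ x ∈ allVecs n ] ∑[ y ∈ allVecs n ] f (x , y)
  sumBy-allPairs n f =
    trans (sumBy-concatMap f _ (allVecs n)) (sumBy-cong (λ x → sumBy-map f (x ,_) (allVecs n)) (allVecs n))

  sumBy-allPairs-splitAt : ∀ n (f : BVec n × BVec n → ℕ) →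
    sumBy f (allPairs n) ≡ ∑[ v ∈ allVecs (n + n) ] f (splitAt n v)
  sumBy-allPairs-splitAt n f = begin
    sumBy f (allPairs n)                                      ≡⟨ sumBy-allPairs n f ⟩
    ∑[ x ∈ allVecs n ] ∑[ y ∈ allVecs n ] f (x , y)           ≡⟨ sumBy-cong (λ x → sumBy-cong (λ y → cong f (sym (splitAt-++ n x y))) (allVecs n)) (allVecs n) ⟩
    ∑[ x ∈ allVecs n ] ∑[ y ∈ allVecs n ] f (splitAt n (x ++ y)) ≡⟨ sym (sumBy-allVecs-++ n n (λ v → f (splitAt n v))) ⟩
    ∑[ v ∈ allVecs (n + n) ] f (splitAt n v)                  ∎
    where open ≡-Reasoning

  -- Enumerating Boolean functions and sparse polynomials

  Fun : ℕ → Set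
  Fun m = BVec m → Bool

  _≗ᶠ_ : Fun m → Fun m → Set
  f ≗ᶠ g = ∀ v → f v ≡ g v

  branch : Fun m → Fun m → Fun (suc m)
  branch f g (false ∷ v) = f v
  branch f g (true ∷ v)  = g v

  allFuns : ∀ m → List (Fun m)
  allFuns zero    = (λ _ → false) ∷ (λ _ → true) ∷ []
  allFuns (suc m) = concatMap (λ f → map (branch f) (allFuns m)) (allFuns m)

  allFuns-complete : ∀ m (h : Fun m) → Σ (Fun m) λ f → f ∈ allFuns m × f ≗ᶠ h
  allFuns-complete zero h with h [] in h[]
  ... | false = _ , here refl , λ { [] → sym h[] }
  ... | true  = _ , there (here refl) , λ { [] → sym h[] }
  allFuns-complete (suc m) h
    with allFuns-complete m (λ v → h (false ∷ v)) | allFuns-complete m (λ v → h (true ∷ v))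
  ... | f , f∈ , f≗ | g , g∈ , g≗ =
    branch f g , ∈-concatMap⁺ _ _ f∈ (∈-map⁺ (branch f) g∈) , λ { (false ∷ v) → f≗ v ; (true ∷ v) → g≗ v }

  _≟ᵛ_ : DecidableEquality (BVec m)
  _≟ᵛ_ = ≡-dec _≟_

  withMonomial : BVec m → Poly m → Poly m
  withMonomial z q u = does (u ≟ᵛ z) ∨ q u

  polysOn : List (BVec m) → List (Poly m)
  polysOn []       = (λ _ → false) ∷ []
  polysOn (z ∷ zs) = concatMap (λ q → q ∷ withMonomial z q ∷ []) (polysOn zs)

  length-polysOn : (zs : List (BVec m)) → length (polysOn zs) ≡ 2 ^ length zs
  length-polysOn []       = refl
  length-polysOn (z ∷ zs) = begin
    length (polysOn (z ∷ zs))    ≡⟨ length≡sumBy-1 (polysOn (z ∷ zs)) ⟩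
    ∑[ _ ∈ polysOn (z ∷ zs) ] 1  ≡⟨ sumBy-concatMap (λ _ → 1) _ (polysOn zs) ⟩
    ∑[ _ ∈ polysOn zs ] 2        ≡⟨ sumBy-const 2 (polysOn zs) ⟩
    2 * length (polysOn zs)      ≡⟨ cong (2 *_) (length-polysOn zs) ⟩
    2 ^ length (z ∷ zs)          ∎
    where open ≡-Reasoning

  polysOn-complete : (zs : List (BVec m)) (Q : Poly m) → (∀ u → Q u ≡ true → u ∈ zs) →
                     Σ (Poly m) λ q → q ∈ polysOn zs × q ≗ᶠ Q
  polysOn-complete [] Q supp = _ , here refl , vanish
    where
    vanish : ∀ u → false ≡ Q u
    vanish u with Q u in Qu
    ... | false = refl
    ... | true with () ← supp u Qu
  polysOn-complete {m} (z ∷ zs) Q supp with polysOn-complete zs Q⁻ supp⁻ | Q z in Qz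
    where
    Q⁻ : Poly m
    Q⁻ u = Q u ∧ not (does (u ≟ᵛ z))
    supp⁻ : ∀ u → Q⁻ u ≡ true → u ∈ zs
    supp⁻ u Q⁻u with Q u in Qu | u ≟ᵛ z
    ... | true | no u≢z with supp u Qu
    ...   | here u≡z = contradiction u≡z u≢z
    ...   | there u∈ = u∈
  ... | q , q∈ , q≗ | true = withMonomial z q , ∈-concatMap⁺ _ _ q∈ (there (here refl)) , agree
    where
    agree : withMonomial z q ≗ᶠ Q
    agree u with u ≟ᵛ z | q≗ u
    ... | yes refl | _   = sym Qz
    ... | no _     | q≗u = trans q≗u (∧-identityʳ (Q u))
  ... | q , q∈ , q≗ | false = q , ∈-concatMap⁺ _ _ q∈ (here refl) , agree
    where
    agree : q ≗ᶠ Q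
    agree u with u ≟ᵛ z | q≗ u
    ... | yes refl | q≗u = trans q≗u Qz′
      where Qz′ : Q z ∧ false ≡ Q z
            Qz′ rewrite Qz = refl
    ... | no _     | q≗u = trans q≗u (∧-identityʳ (Q u))

  lowMonomials : ∀ m → ℕ → List (BVec m)
  lowMonomials m D = filterB (λ u → does (weight u ≤? D)) (allVecs m)

  lowMonomials-complete : ∀ D (Q : Poly m) → DegLe Q D → ∀ u → Q u ≡ true → u ∈ lowMonomials m D
  lowMonomials-complete D Q deg u Qu = ∈-filterB⁺ _ (allVecs _) (∈-allVecs u) (dec-true (weight u ≤? D) (deg u Qu))

  length-lowMonomials : ∀ m D → length (lowMonomials m D) ≤ suc m ^ D
  length-lowMonomials m D = ≤-trans (≤-reflexive (length-filterB _ (allVecs m))) (count m D)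
    where
    count : ∀ m D → ∑[ u ∈ allVecs m ] 𝟙 (does (weight u ≤? D)) ≤ suc m ^ D
    count zero D = ≤-reflexive (sym (^-zeroˡ D))
    count (suc m) zero rewrite sumBy-allVecs-suc m (λ u → 𝟙 (does (weight u ≤? 0)))
                             | sumBy-const 0 (allVecs m) = +-monoˡ-≤ 0 (count m 0)
    count (suc m) (suc D) = begin
      ∑[ u ∈ allVecs (suc m) ] 𝟙 (does (weight u ≤? suc D))
        ≡⟨ sumBy-allVecs-suc m _ ⟩
      ∑[ v ∈ allVecs m ] 𝟙 (does (weight v ≤? suc D)) + ∑[ v ∈ allVecs m ] 𝟙 (does (suc (weight v) ≤? suc D))
        ≤⟨ +-mono-≤ (count m (suc D)) (≤-reflexive (sumBy-cong (λ v → cong 𝟙 (does-≤?-suc (weight v) D)) (allVecs m))) ⟩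
      suc m * suc m ^ D + ∑[ v ∈ allVecs m ] 𝟙 (does (weight v ≤? D))
        ≤⟨ +-monoʳ-≤ (suc m * suc m ^ D) (count m D) ⟩
      suc m * suc m ^ D + suc m ^ D
        ≡⟨ +-comm (suc m * suc m ^ D) _ ⟩
      suc (suc m) * suc m ^ D
        ≤⟨ *-monoʳ-≤ (suc (suc m)) (^-monoˡ-≤ D (n≤1+n (suc m))) ⟩
      suc (suc m) ^ suc D ∎
      where
      open ≤-Reasoning
      does-≤?-suc : ∀ a b → does (suc a ≤? suc b) ≡ does (a ≤? b)
      does-≤?-suc zero    b = refl
      does-≤?-suc (suc a) b = refl

  -- Binomial coefficients mod 2 and the size of S

  xor-cancelʳ : ∀ a b → (a xor b) xor b ≡ a
  xor-cancelʳ a b = trans (xor-assoc a b b) (trans (cong (a xor_) (xor-same b)) (xor-identityʳ a))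

  xor-cancel-middle : ∀ a b c → (a xor b) xor (b xor c) ≡ a xor c
  xor-cancel-middle a b c =
    trans (xor-assoc a b (b xor c)) (cong (a xor_) (trans (sym (xor-assoc b b c)) (cong (_xor c) (xor-same b))))

  parity : ℕ → Bool
  parity zero    = false
  parity (suc k) = not (parity k)

  parity-+ : ∀ a b → parity (a + b) ≡ parity a xor parity b
  parity-+ zero    b = refl
  parity-+ (suc a) b rewrite parity-+ a b = not-distribˡ-xor (parity a) (parity b)

  oddᵇ≡parity : ∀ k → oddᵇ k ≡ parity k
  oddᵇ≡parity 0             = refl
  oddᵇ≡parity 1             = refl
  oddᵇ≡parity (suc (suc k)) = begin
    (suc (suc k) % 2) ≡ᵇ 1   ≡⟨ cong (λ z → (z % 2) ≡ᵇ 1) (+-comm 2 k) ⟩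
    ((k + 2) % 2) ≡ᵇ 1       ≡⟨ cong (_≡ᵇ 1) ([m+n]%n≡m%n k 2) ⟩
    oddᵇ k                   ≡⟨ oddᵇ≡parity k ⟩
    parity k                 ≡⟨ sym (not-involutive (parity k)) ⟩
    parity (suc (suc k))     ∎
    where open ≡-Reasoning

  oddC : ℕ → ℕ → Bool
  oddC w t = parity (w C t)

  oddC-pascal : ∀ w t → oddC (suc w) (suc t) ≡ oddC w t xor oddC w (suc t)
  oddC-pascal w t = trans (cong parity (sym (nCk+nC[k+1]≡[n+1]C[k+1] w t))) (parity-+ (w C t) (w C suc t))

  +-double : ∀ w D → w + (D + (D + 0)) ≡ (w + D) + D
  +-double = solve-∀

  -- (1 + X)^(w + 2^k) = (1 + X)^w (1 + X^(2^k)) over F₂, read off coefficientwise.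
  mutual
    oddC-period : ∀ k w t → t < 2 ^ k → oddC (w + 2 ^ k) t ≡ oddC w t
    oddC-period zero    w zero    _          = refl
    oddC-period zero    w (suc t) (s≤s ())
    oddC-period (suc k) w t t<2D with 2 ^ k ≤? t
    ... | no t≱D = begin
      oddC (w + (D + (D + 0))) t ≡⟨ cong (λ z → oddC z t) (+-double w D) ⟩
      oddC ((w + D) + D) t       ≡⟨ oddC-period k (w + D) t (≰⇒> t≱D) ⟩
      oddC (w + D) t             ≡⟨ oddC-period k w t (≰⇒> t≱D) ⟩
      oddC w t                   ∎
      where open ≡-Reasoning
            D = 2 ^ k
    ... | yes D≤t = begin
      oddC (w + (D + (D + 0))) t                ≡⟨ cong₂ oddC (+-double w D) (sym (m∸n+n≡m D≤t)) ⟩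
      oddC ((w + D) + D) (s + D)                ≡⟨ oddC-shift k (w + D) s ⟩
      oddC (w + D) (s + D) xor oddC (w + D) s   ≡⟨ cong₂ _xor_ (oddC-shift k w s) (oddC-period k w s s<D) ⟩
      (oddC w (s + D) xor oddC w s) xor oddC w s ≡⟨ xor-cancelʳ (oddC w (s + D)) (oddC w s) ⟩
      oddC w (s + D)                            ≡⟨ cong (oddC w) (m∸n+n≡m D≤t) ⟩
      oddC w t                                  ∎
      where open ≡-Reasoning
            D = 2 ^ k
            s = t ∸ D
            s<D : s < D
            s<D = +-cancelʳ-< D s D (subst (_< D + D) (sym (m∸n+n≡m D≤t)) (subst (t <_) (cong (D +_) (+-identityʳ D)) t<2D))

    oddC-shift : ∀ k w s → oddC (w + 2 ^ k) (s + 2 ^ k) ≡ oddC w (s + 2 ^ k) xor oddC w s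
    oddC-shift zero w s rewrite +-comm w 1 | +-comm s 1 = trans (oddC-pascal w s) (xor-comm (oddC w s) (oddC w (suc s)))
    oddC-shift (suc k) w s = begin
      oddC (w + (D + (D + 0))) (s + (D + (D + 0)))
        ≡⟨ cong₂ oddC (+-double w D) (+-double s D) ⟩
      oddC ((w + D) + D) ((s + D) + D)
        ≡⟨ oddC-shift k (w + D) (s + D) ⟩
      oddC (w + D) ((s + D) + D) xor oddC (w + D) (s + D)
        ≡⟨ cong₂ _xor_ (oddC-shift k w (s + D)) (oddC-shift k w s) ⟩
      (oddC w ((s + D) + D) xor oddC w (s + D)) xor (oddC w (s + D) xor oddC w s)
        ≡⟨ xor-cancel-middle (oddC w ((s + D) + D)) (oddC w (s + D)) (oddC w s) ⟩
      oddC w ((s + D) + D) xor oddC w s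
        ≡⟨ cong (λ z → oddC w z xor oddC w s) (sym (+-double s D)) ⟩
      oddC w (s + (D + (D + 0))) xor oddC w s ∎
      where open ≡-Reasoning
            D = 2 ^ k

  weight-replicate-true : ∀ d (v : BVec m) → weight (replicate d true ++ v) ≡ d + weight v
  weight-replicate-true zero    v = refl
  weight-replicate-true (suc d) v = cong suc (weight-replicate-true d v)

  weight-replicate-false : ∀ d (v : BVec m) → weight (replicate d false ++ v) ≡ weight v
  weight-replicate-false zero    v = refl
  weight-replicate-false (suc d) v = weight-replicate-false d v

  Sym-flip-below : ∀ k t (v : BVec m) → t < 2 ^ k →
    Sym t (replicate (2 ^ k) true ++ v) ≡ Sym t (replicate (2 ^ k) false ++ v)
  Sym-flip-below k t v t<
    rewrite weight-replicate-true (2 ^ k) v | weight-replicate-false (2 ^ k) v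
          | oddᵇ≡parity ((2 ^ k + weight v) C t) | oddᵇ≡parity (weight v C t) | +-comm (2 ^ k) (weight v)
    = oddC-period k (weight v) t t<

  Sym-flip-top : ∀ k (v : BVec m) →
    Sym (2 ^ k) (replicate (2 ^ k) true ++ v) ≡ not (Sym (2 ^ k) (replicate (2 ^ k) false ++ v))
  Sym-flip-top k v
    rewrite weight-replicate-true (2 ^ k) v | weight-replicate-false (2 ^ k) v
          | oddᵇ≡parity ((2 ^ k + weight v) C (2 ^ k)) | oddᵇ≡parity (weight v C (2 ^ k)) | +-comm (2 ^ k) (weight v)
    = trans (oddC-shift k (weight v) 0) (trans (xor-comm _ true) (true-xor _))

  xorSum-cong : {f g : A → Bool} → (∀ a → f a ≡ g a) → ∀ xs → xorSum f xs ≡ xorSum g xs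
  xorSum-cong f≡g []       = refl
  xorSum-cong f≡g (a ∷ as) = cong₂ _xor_ (f≡g a) (xorSum-cong f≡g as)

  DSimple-flip : ∀ k (Φ : Poly (2 ^ k + m)) → DSimple (2 ^ k) Φ → ∀ v →
    eval Φ (replicate (2 ^ k) true ++ v) ≡ eval Φ (replicate (2 ^ k) false ++ v)
  DSimple-flip k Φ (c , Φ≡) v =
    trans (Φ≡ _) (trans (xorSum-cong (λ t → cong (c t ∧_) (Sym-flip-below k (toℕ t) v (toℕ<n t))) (allFin (2 ^ k)))
                        (sym (Φ≡ _)))

  -- S_{Φ,Ψ} is the product of the slices of Φ₁ and Ψ₁.
  slice : ℕ → Poly m → BVec m → Bool
  slice d Φ x = does (Sym d x ≟ (true xor eval Φ x))

  slice-flip : ∀ k (Φ : Poly (2 ^ k + m)) → DSimple (2 ^ k) Φ → ∀ v →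
    slice (2 ^ k) Φ (replicate (2 ^ k) false ++ v) ∨ slice (2 ^ k) Φ (replicate (2 ^ k) true ++ v) ≡ true
  slice-flip k Φ simple v =
    subst₂ (λ s e′ → does (a ≟ (true xor e)) ∨ does (s ≟ (true xor e′)) ≡ true)
           (sym (Sym-flip-top k v)) (sym (DSimple-flip k Φ simple v)) (either a e)
    where
    a = Sym (2 ^ k) (replicate (2 ^ k) false ++ v)
    e = eval Φ (replicate (2 ^ k) false ++ v)
    either : ∀ a e → does (a ≟ (true xor e)) ∨ does (not a ≟ (true xor e)) ≡ true
    either true  true  = refl
    either true  false = refl
    either false true  = refl
    either false false = refl

  2^m≤count : ∀ d m → 1 ≤ d → (s : BVec (d + m) → Bool) →
    (∀ v → s (replicate d false ++ v) ∨ s (replicate d true ++ v) ≡ true) →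
    2 ^ m ≤ ∑[ u ∈ allVecs (d + m) ] 𝟙 (s u)
  2^m≤count (suc d) m _ s hit = begin
    2 ^ m
      ≡⟨ trans (sym (length-allVecs m)) (length≡sumBy-1 (allVecs m)) ⟩
    ∑[ _ ∈ allVecs m ] 1
      ≤⟨ sumBy-mono one (allVecs m) ⟩
    ∑[ v ∈ allVecs m ] (𝟙 (s (replicate (suc d) false ++ v)) + 𝟙 (s (replicate (suc d) true ++ v)))
      ≡⟨ sumBy-+ _ _ (allVecs m) ⟩
    G (replicate (suc d) false) + G (replicate (suc d) true)
      ≤⟨ +-mono-≤ (∈⇒≤sumBy (λ u → G (false ∷ u)) _ (∈-allVecs (replicate d false)))
                  (∈⇒≤sumBy (λ u → G (true ∷ u)) _ (∈-allVecs (replicate d true))) ⟩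
    ∑[ u ∈ allVecs d ] G (false ∷ u) + ∑[ u ∈ allVecs d ] G (true ∷ u)
      ≡⟨ sym (sumBy-allVecs-suc d G) ⟩
    sumBy G (allVecs (suc d))
      ≡⟨ sym (sumBy-allVecs-++ (suc d) m (λ u → 𝟙 (s u))) ⟩
    ∑[ u ∈ allVecs (suc d + m) ] 𝟙 (s u) ∎
    where
    open ≤-Reasoning
    G : BVec (suc d) → ℕ
    G u = ∑[ v ∈ allVecs m ] 𝟙 (s (u ++ v))
    one : ∀ v → 1 ≤ 𝟙 (s (replicate (suc d) false ++ v)) + 𝟙 (s (replicate (suc d) true ++ v))
    one v with s (replicate (suc d) false ++ v) | s (replicate (suc d) true ++ v) | hit v
    ... | true  | _    | _ = s≤s z≤n
    ... | false | true | _ = s≤s z≤n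

  4^m≤length-S : ∀ k m (Φ Ψ : Poly (2 ^ k + m)) → DSimple (2 ^ k) Φ → DSimple (2 ^ k) Ψ →
    4 ^ m ≤ length (filterB (inS (2 ^ k) Φ Ψ) (allPairs (2 ^ k + m)))
  4^m≤length-S k m Φ Ψ simpleΦ simpleΨ = begin
    4 ^ m
      ≡⟨ ^-distribʳ-* 2 2 m ⟩
    2 ^ m * 2 ^ m
      ≤⟨ *-mono-≤ (2^m≤count d m (m^n>0 2 k) (slice d Φ) (slice-flip k Φ simpleΦ))
                  (2^m≤count d m (m^n>0 2 k) (slice d Ψ) (slice-flip k Ψ simpleΨ)) ⟩
    ∑[ x ∈ allVecs n ] 𝟙 (slice d Φ x) * ∑[ y ∈ allVecs n ] 𝟙 (slice d Ψ y)
      ≡⟨ sym (sumBy-product _ _ (allVecs n) (allVecs n)) ⟩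
    ∑[ x ∈ allVecs n ] ∑[ y ∈ allVecs n ] (𝟙 (slice d Φ x) * 𝟙 (slice d Ψ y))
      ≡⟨ sym (sumBy-cong (λ x → sumBy-cong (λ y → 𝟙-∧ (slice d Φ x) (slice d Ψ y)) (allVecs n)) (allVecs n)) ⟩
    ∑[ x ∈ allVecs n ] ∑[ y ∈ allVecs n ] 𝟙 (inS d Φ Ψ (x , y))
      ≡⟨ sym (sumBy-allPairs n _) ⟩
    ∑[ p ∈ allPairs n ] 𝟙 (inS d Φ Ψ p)
      ≡⟨ sym (length-filterB (inS d Φ Ψ) (allPairs n)) ⟩
    length (filterB (inS d Φ Ψ) (allPairs n)) ∎
    where
    open ≤-Reasoning
    d = 2 ^ k
    n = d + m

  #ones #zeros : Fun m → ℕ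
  #ones  {m} w = ∑[ v ∈ allVecs m ] 𝟙 (w v)
  #zeros {m} w = ∑[ v ∈ allVecs m ] 𝟙 (not (w v))

  #zerosOn #onesOn : Fun m → Fun m → ℕ
  #zerosOn {m} w g = ∑[ v ∈ allVecs m ] 𝟙 (w v ∧ not (g v))
  #onesOn  {m} w g = ∑[ v ∈ allVecs m ] 𝟙 (w v ∧ g v)

  #ones+#zeros : ∀ m (w : Fun m) → #ones w + #zeros w ≡ 2 ^ m
  #ones+#zeros m w = begin
    #ones w + #zeros w                            ≡⟨ sym (sumBy-+ _ _ (allVecs m)) ⟩
    ∑[ v ∈ allVecs m ] (𝟙 (w v) + 𝟙 (not (w v))) ≡⟨ sumBy-cong (λ v → one (w v)) (allVecs m) ⟩
    ∑[ _ ∈ allVecs m ] 1                          ≡⟨ sym (length≡sumBy-1 (allVecs m)) ⟩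
    length (allVecs m)                            ≡⟨ length-allVecs m ⟩
    2 ^ m                                         ∎
    where
    open ≡-Reasoning
    one : ∀ b → 𝟙 b + 𝟙 (not b) ≡ 1
    one true  = refl
    one false = refl

  #zerosOn+#onesOn : (w g : Fun m) → #zerosOn w g + #onesOn w g ≡ #ones w
  #zerosOn+#onesOn {m} w g = trans (sym (sumBy-+ _ _ (allVecs m))) (sumBy-cong (λ v → split (w v) (g v)) (allVecs m))
    where
    split : ∀ a b → 𝟙 (a ∧ not b) + 𝟙 (a ∧ b) ≡ 𝟙 a
    split true  true  = refl
    split true  false = refl
    split false _     = refl

  ^-*-interchange : ∀ a b c d e f → a ^ (b + c) * d ^ (e + f) ≡ a ^ b * d ^ e * (a ^ c * d ^ f)
  ^-*-interchange a b c d e f rewrite ^-distribˡ-+-* a b c | ^-distribˡ-+-* d e f =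
    interchange (a ^ b) (a ^ c) (d ^ e) (d ^ f)
    where interchange : ∀ x y z u → x * y * (z * u) ≡ x * z * (y * u)
          interchange = solve-∀

  -- The sum factorises over the points of the cube: each point v with w v contributes a factor p + q,
  -- each other point a factor 2.
  allFuns-binomial : ∀ p q m (w : Fun m) →
    ∑[ g ∈ allFuns m ] (p ^ #zerosOn w g * q ^ #onesOn w g) ≡ 2 ^ #zeros w * (p + q) ^ #ones w
  allFuns-binomial p q zero w with w []
  ... | true  = base p q
    where base : ∀ p q → p * 1 * 1 + (1 * (q * 1) + 0) ≡ 1 * ((p + q) * 1)
          base = solve-∀
  ... | false = refl
  allFuns-binomial p q (suc m) w = begin
    sumBy T (concatMap (λ f → map (branch f) (allFuns m)) (allFuns m))
      ≡⟨ sumBy-concatMap T _ (allFuns m) ⟩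
    ∑[ f ∈ allFuns m ] sumBy T (map (branch f) (allFuns m))
      ≡⟨ sumBy-cong (λ f → sumBy-map T (branch f) (allFuns m)) (allFuns m) ⟩
    ∑[ f ∈ allFuns m ] ∑[ g ∈ allFuns m ] T (branch f g)
      ≡⟨ sumBy-cong (λ f → sumBy-cong (T-branch f) (allFuns m)) (allFuns m) ⟩
    ∑[ f ∈ allFuns m ] ∑[ g ∈ allFuns m ] (T₀ f * T₁ g)
      ≡⟨ sumBy-product T₀ T₁ (allFuns m) (allFuns m) ⟩
    sumBy T₀ (allFuns m) * sumBy T₁ (allFuns m)
      ≡⟨ cong₂ _*_ (allFuns-binomial p q m w₀) (allFuns-binomial p q m w₁) ⟩
    2 ^ #zeros w₀ * (p + q) ^ #ones w₀ * (2 ^ #zeros w₁ * (p + q) ^ #ones w₁)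
      ≡⟨ sym (^-*-interchange 2 (#zeros w₀) (#zeros w₁) (p + q) (#ones w₀) (#ones w₁)) ⟩
    2 ^ (#zeros w₀ + #zeros w₁) * (p + q) ^ (#ones w₀ + #ones w₁)
      ≡⟨ sym (cong₂ (λ a b → 2 ^ a * (p + q) ^ b) (sumBy-allVecs-suc m _) (sumBy-allVecs-suc m _)) ⟩
    2 ^ #zeros w * (p + q) ^ #ones w ∎
    where
    open ≡-Reasoning
    w₀ w₁ : Fun m
    w₀ v = w (false ∷ v)
    w₁ v = w (true ∷ v)
    T : Fun (suc m) → ℕ
    T g = p ^ #zerosOn w g * q ^ #onesOn w g
    T₀ T₁ : Fun m → ℕ
    T₀ f = p ^ #zerosOn w₀ f * q ^ #onesOn w₀ f
    T₁ g = p ^ #zerosOn w₁ g * q ^ #onesOn w₁ g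
    T-branch : ∀ f g → T (branch f g) ≡ T₀ f * T₁ g
    T-branch f g
      rewrite sumBy-allVecs-suc m (λ v → 𝟙 (w v ∧ not (branch f g v)))
            | sumBy-allVecs-suc m (λ v → 𝟙 (w v ∧ branch f g v))
      = ^-*-interchange p (#zerosOn w₀ f) (#zerosOn w₁ g) q (#onesOn w₀ f) (#onesOn w₁ g)

  ^-cancelˡ-≤ : ∀ k .{{_ : NonZero k}} a b → a ^ k ≤ b ^ k → a ≤ b
  ^-cancelˡ-≤ k a b aᵏ≤bᵏ with a ≤? b
  ... | yes a≤b = a≤b
  ... | no  a≰b = contradiction aᵏ≤bᵏ (<⇒≱ (^-monoˡ-< k (≰⇒> a≰b)))

  n<2^n : ∀ n → n < 2 ^ n
  n<2^n zero    = s≤s z≤n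
  n<2^n (suc n) = +-mono-≤ (m^n>0 2 n) (subst (n <_) (sym (+-identityʳ (2 ^ n))) (n<2^n n))

  [x+1]^j*x≤x^j*[x+2j] : ∀ x j → 2 * j ≤ x → (x + 1) ^ j * x ≤ x ^ j * (x + 2 * j)
  [x+1]^j*x≤x^j*[x+2j] x zero    _    = ≤-reflexive (base x)
    where base : ∀ x → 1 * x ≡ 1 * (x + 2 * 0)
          base = solve-∀
  [x+1]^j*x≤x^j*[x+2j] x (suc j) 2j≤x = begin
    (x + 1) * (x + 1) ^ j * x                 ≡⟨ *-assoc (x + 1) _ x ⟩
    (x + 1) * ((x + 1) ^ j * x)               ≤⟨ *-monoʳ-≤ (x + 1) ([x+1]^j*x≤x^j*[x+2j] x j 2j′≤x) ⟩
    (x + 1) * (x ^ j * (x + 2 * j))           ≡⟨ expand x (x ^ j) j ⟩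
    x ^ j * ((x * x + 2 * j * x + x) + 2 * j) ≤⟨ *-monoʳ-≤ (x ^ j) (+-monoʳ-≤ (x * x + 2 * j * x + x) 2j′≤x) ⟩
    x ^ j * ((x * x + 2 * j * x + x) + x)     ≡⟨ collect x (x ^ j) j ⟩
    x * x ^ j * (x + 2 * suc j)               ∎
    where
    open ≤-Reasoning
    2j′≤x : 2 * j ≤ x
    2j′≤x = ≤-trans (*-monoʳ-≤ 2 (n≤1+n j)) 2j≤x
    expand : ∀ x A j → (x + 1) * (A * (x + 2 * j)) ≡ A * ((x * x + 2 * j * x + x) + 2 * j)
    expand = solve-∀
    collect : ∀ x A j → A * ((x * x + 2 * j * x + x) + x) ≡ x * A * (x + 2 * (1 + j))
    collect = solve-∀

  [x+1]^D≤2*x^D : ∀ x D .{{_ : NonZero x}} → 2 * D ≤ x → (x + 1) ^ D ≤ 2 * x ^ D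
  [x+1]^D≤2*x^D x D 2D≤x = *-cancelʳ-≤ _ _ x (begin
    (x + 1) ^ D * x       ≤⟨ [x+1]^j*x≤x^j*[x+2j] x D 2D≤x ⟩
    x ^ D * (x + 2 * D)   ≤⟨ *-monoʳ-≤ (x ^ D) (+-monoʳ-≤ x 2D≤x) ⟩
    x ^ D * (x + x)       ≡⟨ double (x ^ D) x ⟩
    2 * x ^ D * x         ∎)
    where
    open ≤-Reasoning
    double : ∀ A x → A * (x + x) ≡ 2 * A * x
    double = solve-∀

  a^[j+1]+j*a^j≤a*[a+1]^j : ∀ a j → a ^ suc j + j * a ^ j ≤ a * (a + 1) ^ j
  a^[j+1]+j*a^j≤a*[a+1]^j a zero    = ≤-reflexive (+-identityʳ _)
  a^[j+1]+j*a^j≤a*[a+1]^j a (suc j) = begin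
    a * (a * a ^ j) + suc j * (a * a ^ j)                ≤⟨ m≤m+n _ (j * a ^ j) ⟩
    a * (a * a ^ j) + suc j * (a * a ^ j) + j * a ^ j    ≡⟨ factor a j (a ^ j) ⟩
    (a + 1) * (a * a ^ j + j * a ^ j)                    ≤⟨ *-monoʳ-≤ (a + 1) (a^[j+1]+j*a^j≤a*[a+1]^j a j) ⟩
    (a + 1) * (a * (a + 1) ^ j)                          ≡⟨ swap (a + 1) a ((a + 1) ^ j) ⟩
    a * ((a + 1) * (a + 1) ^ j)                          ∎
    where
    open ≤-Reasoning
    factor : ∀ a j A → a * (a * A) + suc j * (a * A) + j * A ≡ (a + 1) * (a * A + j * A)
    factor = solve-∀
    swap : ∀ x y z → x * (y * z) ≡ y * (x * z)
    swap = solve-∀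

  2*a^a≤[a+1]^a : ∀ a .{{_ : NonZero a}} → 2 * a ^ a ≤ (a + 1) ^ a
  2*a^a≤[a+1]^a a = *-cancelʳ-≤ _ _ a (subst₂ _≤_ (double a (a ^ a)) (*-comm a _) (a^[j+1]+j*a^j≤a*[a+1]^j a a))
    where double : ∀ a A → a * A + a * A ≡ 2 * A * a
          double = solve-∀

  2^j*u^M≤w^M : ∀ u w j M .{{_ : NonZero u}} → u < w → u * j ≤ M → 2 ^ j * u ^ M ≤ w ^ M
  2^j*u^M≤w^M u w j M u<w uj≤M with m≤n⇒∃[o]m+o≡n uj≤M
  ... | r , refl = begin
    2 ^ j * u ^ (u * j + r)            ≡⟨ cong (2 ^ j *_) (^-distribˡ-+-* u (u * j) r) ⟩
    2 ^ j * (u ^ (u * j) * u ^ r)      ≡⟨ cong (λ z → 2 ^ j * (z * u ^ r)) (sym (^-*-assoc u u j)) ⟩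
    2 ^ j * ((u ^ u) ^ j * u ^ r)      ≡⟨ sym (*-assoc (2 ^ j) _ _) ⟩
    2 ^ j * (u ^ u) ^ j * u ^ r        ≡⟨ cong (_* u ^ r) (sym (^-distribʳ-* 2 (u ^ u) j)) ⟩
    (2 * u ^ u) ^ j * u ^ r            ≤⟨ *-mono-≤ (^-monoˡ-≤ j 2uᵘ≤wᵘ) (^-monoˡ-≤ r (<⇒≤ u<w)) ⟩
    (w ^ u) ^ j * w ^ r                ≡⟨ cong (_* w ^ r) (^-*-assoc w u j) ⟩
    w ^ (u * j) * w ^ r                ≡⟨ sym (^-distribˡ-+-* w (u * j) r) ⟩
    w ^ (u * j + r)                    ∎
    where
    open ≤-Reasoning
    2uᵘ≤wᵘ : 2 * u ^ u ≤ w ^ u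
    2uᵘ≤wᵘ = ≤-trans (2*a^a≤[a+1]^a u) (^-monoˡ-≤ u (subst (_≤ w) (+-comm 1 u) u<w))

  [2K*2^N]^2K≤2^[2K*[2K+N]] : ∀ K N → (2 * K * 2 ^ N) ^ (2 * K) ≤ 2 ^ (2 * K * (2 * K + N))
  [2K*2^N]^2K≤2^[2K*[2K+N]] K N = begin
    (2 * K * 2 ^ N) ^ (2 * K)          ≤⟨ ^-monoˡ-≤ (2 * K) (*-monoˡ-≤ (2 ^ N) (<⇒≤ (n<2^n (2 * K)))) ⟩
    (2 ^ (2 * K) * 2 ^ N) ^ (2 * K)    ≡⟨ cong (_^ (2 * K)) (sym (^-distribˡ-+-* 2 (2 * K) N)) ⟩
    (2 ^ (2 * K + N)) ^ (2 * K)        ≡⟨ ^-*-assoc 2 (2 * K + N) (2 * K) ⟩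
    2 ^ ((2 * K + N) * (2 * K))        ≡⟨ cong (2 ^_) (*-comm (2 * K + N) (2 * K)) ⟩
    2 ^ (2 * K * (2 * K + N))          ∎
    where open ≤-Reasoning

  c*[m+1]^D≤4^m : ∀ c D m → 2 * D + c * (2 * D + 1) ^ D ≤ m → c * (m + 1) ^ D ≤ 4 ^ m
  c*[m+1]^D≤4^m c D m m≥ with m≤n⇒∃[o]m+o≡n m≥
  ... | r , refl = *-cancelʳ-≤ _ _ (2 ^ s) {{m^n≢0 2 s}} (begin
    c * ((a + t) + r + 1) ^ D * 2 ^ s  ≡⟨ cong (λ z → c * (z + 1) ^ D * 2 ^ s) (+-assoc a t r) ⟩
    c * (a + s + 1) ^ D * 2 ^ s        ≤⟨ doubling s ⟩
    t * 4 ^ s                          ≤⟨ *-monoˡ-≤ (4 ^ s) (<⇒≤ (<-≤-trans (n<2^n t) (^-monoʳ-≤ 2 (m≤m+n t r)))) ⟩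
    2 ^ s * 4 ^ s                      ≤⟨ subst (2 ^ s * 4 ^ s ≤_) (*-comm (2 ^ s) _) (*-monoʳ-≤ (2 ^ s) (^-monoʳ-≤ 4 (m≤n+m s a))) ⟩
    4 ^ (a + s) * 2 ^ s                ≡⟨ cong (λ z → 4 ^ z * 2 ^ s) (sym (+-assoc a t r)) ⟩
    4 ^ ((a + t) + r) * 2 ^ s          ∎)
    where
    open ≤-Reasoning
    a = 2 * D
    t = c * (2 * D + 1) ^ D
    s = t + r
    -- Each increment of s at most doubles (a + s + 1)^D, while 4^s quadruples.
    doubling : ∀ s → c * (a + s + 1) ^ D * 2 ^ s ≤ t * 4 ^ s
    doubling zero    = ≤-reflexive (cong (λ z → c * (z + 1) ^ D * 1) (+-identityʳ a))
    doubling (suc s) = begin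
      c * (a + suc s + 1) ^ D * (2 * 2 ^ s)       ≡⟨ cong (λ z → c * z ^ D * (2 * 2 ^ s)) (shift a s) ⟩
      c * ((a + s + 1) + 1) ^ D * (2 * 2 ^ s)     ≤⟨ *-monoˡ-≤ (2 * 2 ^ s) (*-monoʳ-≤ c step) ⟩
      c * (2 * (a + s + 1) ^ D) * (2 * 2 ^ s)     ≡⟨ regroup c ((a + s + 1) ^ D) (2 ^ s) ⟩
      4 * (c * (a + s + 1) ^ D * 2 ^ s)           ≤⟨ *-monoʳ-≤ 4 (doubling s) ⟩
      4 * (t * 4 ^ s)                             ≡⟨ swap t (4 ^ s) ⟩
      t * (4 * 4 ^ s)                             ∎
      where
      step : ((a + s + 1) + 1) ^ D ≤ 2 * (a + s + 1) ^ D
      step = [x+1]^D≤2*x^D (a + s + 1) D {{subst NonZero (+-comm 1 (a + s)) _}} (≤-trans (m≤m+n a s) (m≤m+n (a + s) 1))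
      shift : ∀ a s → a + suc s + 1 ≡ a + s + 1 + 1
      shift = solve-∀
      regroup : ∀ c A B → c * (2 * A) * (2 * B) ≡ 4 * (c * A * B)
      regroup = solve-∀
      swap : ∀ t F → 4 * (t * F) ≡ t * (4 * F)
      swap = solve-∀

  -- For K ≥ 2 and p = K + 1, q = K: a term p^Z q^Y with Z + Y = M and Z ≥ (1/2 + 1/K) M has 2K-th power
  -- at least V^M, whereas the 2K-th power of (p + q)^M is U^M.
  U V W : ℕ → ℕ
  U K = (2 * K + 1) ^ (2 * K)
  V K = suc K ^ (K + 2) * K ^ (K ∸ 2)
  W K = 2 ^ (2 * K) * V K

  U<W : ∀ k → U (2 + k) < W (2 + k)
  U<W k = *-cancelʳ-< (K * K * x) (U K) (W K) (begin-strict
    U K * (K * K * x)                     ≡⟨ cong (_* (K * K * x)) U≡ ⟩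
    (x + 1) ^ K * (K * K * x)             ≡⟨ regroup ((x + 1) ^ K) (K * K) x ⟩
    (x + 1) ^ K * x * (K * K)             ≤⟨ *-monoˡ-≤ (K * K) ([x+1]^j*x≤x^j*[x+2j] x K 2K≤x) ⟩
    x ^ K * (x + 2 * K) * (K * K)         ≡⟨ *-assoc (x ^ K) _ _ ⟩
    x ^ K * ((x + 2 * K) * (K * K))       <⟨ *-monoʳ-< (x ^ K) {{m^n≢0 x K}} key ⟩
    x ^ K * ((K + 1) * (K + 1) * x)       ≡⟨ sym W≡ ⟩
    W K * (K * K * x)                     ∎)
    where
    open ≤-Reasoning
    K = 2 + k
    x = 4 * K * (K + 1)
    2K≤x : 2 * K ≤ x
    2K≤x = subst (_≤ x) (*-comm K 2) (subst (K * 2 ≤_) (sym (x≡ K)) (m≤m*n (K * 2) (2 * (K + 1))))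
      where x≡ : ∀ K → 4 * K * (K + 1) ≡ K * 2 * (2 * (K + 1))
            x≡ = solve-∀
    regroup : ∀ a b c → a * (b * c) ≡ (a * c) * b
    regroup = solve-∀
    U≡ : U K ≡ (x + 1) ^ K
    U≡ = trans (sym (^-*-assoc (2 * K + 1) 2 K)) (cong (_^ K) (square K))
      where square : ∀ K → (2 * K + 1) * ((2 * K + 1) * 1) ≡ 4 * K * (K + 1) + 1
            square = solve-∀
    key : (x + 2 * K) * (K * K) < (K + 1) * (K + 1) * x
    key = subst ((x + 2 * K) * (K * K) <_) (sym (gap k)) (m<m+n _ (s≤s z≤n))
      where gap : ∀ k → (2 + k + 1) * (2 + k + 1) * (4 * (2 + k) * (2 + k + 1))
                      ≡ (4 * (2 + k) * (2 + k + 1) + 2 * (2 + k)) * ((2 + k) * (2 + k))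
                        + suc (6 * k * k * k + 48 * k * k + 124 * k + 103)
            gap = solve-∀
    W≡ : W K * (K * K * x) ≡ x ^ K * ((K + 1) * (K + 1) * x)
    W≡ = begin-equality
      2 ^ (2 * K) * (suc K ^ (K + 2) * K ^ k) * (K * K * x)
        ≡⟨ cong₂ (λ a b → a * (b * K ^ k) * (K * K * x)) (sym (^-*-assoc 2 2 K)) (^-distribˡ-+-* (suc K) K 2) ⟩
      4 ^ K * (suc K ^ K * suc K ^ 2 * K ^ k) * (K * K * x)
        ≡⟨ regroup′ (4 ^ K) (suc K ^ K) (K ^ k) K x ⟩
      4 ^ K * suc K ^ K * (K * (K * K ^ k)) * ((K + 1) * (K + 1) * x)
        ≡⟨ cong (_* ((K + 1) * (K + 1) * x)) (trans (cong (_* K ^ K) (sym (^-distribʳ-* 4 (suc K) K)))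
                                                     (sym (^-distribʳ-* (4 * suc K) K K))) ⟩
      (4 * suc K * K) ^ K * ((K + 1) * (K + 1) * x)
        ≡⟨ cong (λ z → z ^ K * ((K + 1) * (K + 1) * x)) (x≡ K) ⟩
      x ^ K * ((K + 1) * (K + 1) * x) ∎
      where
      regroup′ : ∀ a b c K x → a * (b * (suc K * (suc K * 1)) * c) * (K * K * x)
                              ≡ a * b * (K * (K * c)) * ((K + 1) * (K + 1) * x)
      regroup′ = solve-∀
      x≡ : ∀ K → 4 * suc K * K ≡ 4 * K * (K + 1)
      x≡ = solve-∀

  -- A Chernoff bound

  length*μ≤sumBy : (f : A → ℕ) (μ : ℕ) (xs : List A) → All (λ x → μ ≤ f x) xs → length xs * μ ≤ sumBy f xs
  length*μ≤sumBy f μ []       []          = z≤n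
  length*μ≤sumBy f μ (x ∷ xs) (μ≤ ∷ μ≤s) = +-mono-≤ μ≤ (length*μ≤sumBy f μ xs μ≤s)

  -- Through the least value μ of f on xs: c ≤ μ^k and length xs · μ ≤ Σ f.
  length^k*c≤sumBy^k : (f : A → ℕ) (xs : List A) (k : ℕ) .{{_ : NonZero k}} (c : ℕ) →
    All (λ x → c ≤ f x ^ k) xs → length xs ^ k * c ≤ sumBy f xs ^ k
  length^k*c≤sumBy^k f [] (suc k) c _ = z≤n
  length^k*c≤sumBy^k f (x ∷ xs) k c c≤ = begin
    length (x ∷ xs) ^ k * c      ≤⟨ *-monoʳ-≤ (length (x ∷ xs) ^ k) (argmin-all f {P = λ y → c ≤ f y ^ k} (All.head c≤) (All.tail c≤)) ⟩
    length (x ∷ xs) ^ k * μ ^ k  ≡⟨ sym (^-distribʳ-* (length (x ∷ xs)) μ k) ⟩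
    (length (x ∷ xs) * μ) ^ k    ≤⟨ ^-monoˡ-≤ k (length*μ≤sumBy f μ (x ∷ xs) (f[argmin]≤f[⊤] {f = f} x xs ∷ f[argmin]≤f[xs] {f = f} x xs)) ⟩
    sumBy f (x ∷ xs) ^ k         ∎
    where
    open ≤-Reasoning
    μ = f (argmin f x xs)

  count^k*c≤sumBy^k : (f : A → ℕ) (s : A → Bool) (xs : List A) (k : ℕ) .{{_ : NonZero k}} (c : ℕ) →
    (∀ x → s x ≡ true → c ≤ f x ^ k) → (∑[ x ∈ xs ] 𝟙 (s x)) ^ k * c ≤ sumBy f xs ^ k
  count^k*c≤sumBy^k f s xs k c c≤ = begin
    (∑[ x ∈ xs ] 𝟙 (s x)) ^ k * c   ≡⟨ cong (λ z → z ^ k * c) (sym (length-filterB s xs)) ⟩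
    length (filterB s xs) ^ k * c   ≤⟨ length^k*c≤sumBy^k f (filterB s xs) k c (All.tabulate (λ x∈ → c≤ _ (∈-filterB⁻ s xs x∈))) ⟩
    sumBy f (filterB s xs) ^ k      ≤⟨ ^-monoˡ-≤ k (sumBy-filterB≤ s f xs) ⟩
    sumBy f xs ^ k                  ∎
    where open ≤-Reasoning

  V^M≤heavy-term^2K : ∀ k Z Y M → let K = 2 + k in
    Z + Y ≡ M → (K + 2) * M ≤ 2 * K * Z → V K ^ M ≤ (suc K ^ Z * K ^ Y) ^ (2 * K)
  V^M≤heavy-term^2K k Z Y M Z+Y≡M heavy with m≤n⇒∃[o]m+o≡n heavy
  ... | e , [K+2]M+e≡2KZ = *-cancelʳ-≤ _ _ (q ^ e) {{m^n≢0 q e}} (begin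
    (p ^ (K + 2) * q ^ k) ^ M * q ^ e
      ≡⟨ cong (_* q ^ e) (trans (^-distribʳ-* (p ^ (K + 2)) (q ^ k) M) (cong₂ _*_ (^-*-assoc p (K + 2) M) (^-*-assoc q k M))) ⟩
    p ^ ((K + 2) * M) * q ^ (k * M) * q ^ e
      ≤⟨ *-monoʳ-≤ (p ^ ((K + 2) * M) * q ^ (k * M)) (^-monoˡ-≤ e (n≤1+n q)) ⟩
    p ^ ((K + 2) * M) * q ^ (k * M) * p ^ e
      ≡⟨ swap (p ^ ((K + 2) * M)) (q ^ (k * M)) (p ^ e) ⟩
    p ^ ((K + 2) * M) * p ^ e * q ^ (k * M)
      ≡⟨ cong₂ _*_ (trans (sym (^-distribˡ-+-* p ((K + 2) * M) e)) (cong (p ^_) [K+2]M+e≡2KZ)) (cong (q ^_) (sym 2KY+e≡kM)) ⟩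
    p ^ (2 * K * Z) * q ^ (2 * K * Y + e)
      ≡⟨ cong (p ^ (2 * K * Z) *_) (^-distribˡ-+-* q (2 * K * Y) e) ⟩
    p ^ (2 * K * Z) * (q ^ (2 * K * Y) * q ^ e)
      ≡⟨ sym (*-assoc (p ^ (2 * K * Z)) _ _) ⟩
    p ^ (2 * K * Z) * q ^ (2 * K * Y) * q ^ e
      ≡⟨ cong (_* q ^ e) (sym (trans (^-distribʳ-* (p ^ Z) (q ^ Y) (2 * K)) (cong₂ _*_ (power p Z) (power q Y)))) ⟩
    (p ^ Z * q ^ Y) ^ (2 * K) * q ^ e ∎)
    where
    open ≤-Reasoning
    K = 2 + k
    p = suc K
    q = K
    power : ∀ a b → (a ^ b) ^ (2 * K) ≡ a ^ (2 * K * b)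
    power a b = trans (^-*-assoc a b (2 * K)) (cong (a ^_) (*-comm b (2 * K)))
    swap : ∀ a b c → a * b * c ≡ (a * c) * b
    swap = solve-∀
    2KY+e≡kM : 2 * K * Y + e ≡ k * M
    2KY+e≡kM = +-cancelˡ-≡ ((K + 2) * M) _ _ (begin-equality
      (K + 2) * M + (2 * K * Y + e)  ≡⟨ move ((K + 2) * M) (2 * K * Y) e ⟩
      ((K + 2) * M + e) + 2 * K * Y  ≡⟨ cong (_+ 2 * K * Y) [K+2]M+e≡2KZ ⟩
      2 * K * Z + 2 * K * Y          ≡⟨ sym (*-distribˡ-+ (2 * K) Z Y) ⟩
      2 * K * (Z + Y)                ≡⟨ cong (2 * K *_) Z+Y≡M ⟩
      2 * K * M                      ≡⟨ split k M ⟩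
      (K + 2) * M + k * M            ∎)
      where
      move : ∀ a b c → a + (b + c) ≡ (a + c) + b
      move = solve-∀
      split : ∀ k M → 2 * (2 + k) * M ≡ (2 + k + 2) * M + k * M
      split = solve-∀

  -- Multiplying the two hypotheses eliminates v^M.
  c₀*c≤2^[M+M′] : ∀ t .{{_ : NonZero t}} b c₀ c M M′ v .{{_ : NonZero v}} →
    c ^ t * v ^ M ≤ (2 ^ M′ * b ^ M) ^ t → c₀ ^ t * (b ^ t) ^ M ≤ (2 ^ t * v) ^ M → c₀ * c ≤ 2 ^ (M + M′)
  c₀*c≤2^[M+M′] t b c₀ c M M′ v c-bound c₀-bound =
    ^-cancelˡ-≤ t _ _ (*-cancelʳ-≤ _ _ [2^t*v]^M {{m^n≢0 (2 ^ t * v) M {{m*n≢0 (2 ^ t) v {{m^n≢0 2 t}}}}}} (begin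
      (c₀ * c) ^ t * [2^t*v]^M
        ≡⟨ cong₂ _*_ (^-distribʳ-* c₀ c t) (trans (^-distribʳ-* (2 ^ t) v M) (cong (_* v ^ M) (power 2 t M))) ⟩
      c₀ ^ t * c ^ t * (2 ^ (M * t) * v ^ M)
        ≡⟨ interchange (c₀ ^ t) (c ^ t) (2 ^ (M * t)) (v ^ M) ⟩
      c₀ ^ t * 2 ^ (M * t) * (c ^ t * v ^ M)
        ≤⟨ *-monoʳ-≤ (c₀ ^ t * 2 ^ (M * t)) c-bound ⟩
      c₀ ^ t * 2 ^ (M * t) * (2 ^ M′ * b ^ M) ^ t
        ≡⟨ cong (c₀ ^ t * 2 ^ (M * t) *_) (trans (^-distribʳ-* (2 ^ M′) (b ^ M) t)
                                                  (cong₂ _*_ (^-*-assoc 2 M′ t) (trans (power b M t) (sym (^-*-assoc b t M))))) ⟩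
      c₀ ^ t * 2 ^ (M * t) * (2 ^ (M′ * t) * (b ^ t) ^ M)
        ≡⟨ rotate (c₀ ^ t) (2 ^ (M * t)) (2 ^ (M′ * t)) ((b ^ t) ^ M) ⟩
      2 ^ (M * t) * 2 ^ (M′ * t) * (c₀ ^ t * (b ^ t) ^ M)
        ≤⟨ *-monoʳ-≤ (2 ^ (M * t) * 2 ^ (M′ * t)) c₀-bound ⟩
      2 ^ (M * t) * 2 ^ (M′ * t) * [2^t*v]^M
        ≡⟨ cong (_* [2^t*v]^M) (trans (sym (^-distribˡ-+-* 2 (M * t) (M′ * t)))
                                        (trans (cong (2 ^_) (sym (*-distribʳ-+ t M M′))) (sym (^-*-assoc 2 (M + M′) t)))) ⟩
      (2 ^ (M + M′)) ^ t * [2^t*v]^M ∎))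
    where
    open ≤-Reasoning
    [2^t*v]^M = (2 ^ t * v) ^ M
    power : ∀ a b c → (a ^ b) ^ c ≡ a ^ (c * b)
    power a b c = trans (^-*-assoc a b c) (cong (a ^_) (*-comm b c))
    interchange : ∀ a b c d → a * b * (c * d) ≡ a * c * (b * d)
    interchange = solve-∀
    rotate : ∀ a b c d → a * b * (c * d) ≡ (b * c) * (a * d)
    rotate = solve-∀

  exceeds : ℕ → Fun m → ℕ → Bool
  exceeds K w a = not (does (2 * K * a ≤? (K + 2) * #ones w))

  balanced : ℕ → Fun m → Fun m → Bool
  balanced K w g = not (exceeds K w (#zerosOn w g)) ∧ not (exceeds K w (#onesOn w g))

  exceeds⇒ : ∀ K (w : Fun m) a → exceeds K w a ≡ true → (K + 2) * #ones w ≤ 2 * K * a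
  exceeds⇒ K w a exc = <⇒≤ (≰⇒> λ ≤ → contradiction (trans (sym exc) (cong not (dec-true (2 * K * a ≤? (K + 2) * #ones w) ≤))) λ ())

  -- Markov's inequality for the generating function: each exceeding g contributes a term of 2K-th power ≥ V^M.
  exceeding-count : ∀ k (w : Fun m) (a b : Fun m → ℕ) → let K = 2 + k in
    (∀ g → a g + b g ≡ #ones w) →
    ∑[ g ∈ allFuns m ] (suc K ^ a g * K ^ b g) ≡ 2 ^ #zeros w * (2 * K + 1) ^ #ones w →
    (∑[ g ∈ allFuns m ] 𝟙 (exceeds K w (a g))) ^ (2 * K) * V K ^ #ones w ≤ (2 ^ #zeros w * (2 * K + 1) ^ #ones w) ^ (2 * K)
  exceeding-count {m} k w a b a+b≡ enumerator =
    subst (λ z → (∑[ g ∈ allFuns m ] 𝟙 (exceeds K w (a g))) ^ (2 * K) * V K ^ #ones w ≤ z ^ (2 * K)) enumerator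
      (count^k*c≤sumBy^k (λ g → suc K ^ a g * K ^ b g) (λ g → exceeds K w (a g)) (allFuns m) (2 * K) (V K ^ #ones w)
        (λ g exc → V^M≤heavy-term^2K k (a g) (b g) (#ones w) (a+b≡ g) (exceeds⇒ K w (a g) exc)))
    where K = 2 + k

  unbalanced-count : ∀ k (w : Fun m) N → let K = 2 + k in
    U K * (2 * K * (2 * K + N)) ≤ #ones w →
    K * 2 ^ N * ∑[ g ∈ allFuns m ] 𝟙 (not (balanced K w g)) ≤ 2 ^ (2 ^ m)
  unbalanced-count {m} k w N large = subst (K * 2 ^ N * #unbalanced ≤_) (cong (2 ^_) (#ones+#zeros m w)) (*-cancelˡ-≤ 2 (begin
    2 * (K * 2 ^ N * #unbalanced)          ≤⟨ *-monoʳ-≤ 2 (*-monoʳ-≤ (K * 2 ^ N) unbalanced≤) ⟩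
    2 * (K * 2 ^ N * (#heavy₀ + #heavy₁))  ≡⟨ distribute K (2 ^ N) #heavy₀ #heavy₁ ⟩
    c₀ * #heavy₀ + c₀ * #heavy₁            ≤⟨ +-mono-≤ (bound #heavy₀ heavy₀) (bound #heavy₁ heavy₁) ⟩
    2 ^ (M + M′) + 2 ^ (M + M′)            ≡⟨ sym (cong (2 ^ (M + M′) +_) (+-identityʳ _)) ⟩
    2 * 2 ^ (M + M′)                       ∎))
    where
    open ≤-Reasoning
    K = 2 + k
    M = #ones w
    M′ = #zeros w
    c₀ = 2 * K * 2 ^ N
    #unbalanced #heavy₀ #heavy₁ : ℕ
    #unbalanced = ∑[ g ∈ allFuns m ] 𝟙 (not (balanced K w g))
    #heavy₀ = ∑[ g ∈ allFuns m ] 𝟙 (exceeds K w (#zerosOn w g))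
    #heavy₁ = ∑[ g ∈ allFuns m ] 𝟙 (exceeds K w (#onesOn w g))
    unbalanced≤ : #unbalanced ≤ #heavy₀ + #heavy₁
    unbalanced≤ = ≤-trans (sumBy-mono (λ g → either (exceeds K w (#zerosOn w g)) (exceeds K w (#onesOn w g))) (allFuns m))
                          (≤-reflexive (sumBy-+ _ _ (allFuns m)))
      where either : ∀ a b → 𝟙 (not (not a ∧ not b)) ≤ 𝟙 a + 𝟙 b
            either true  _     = s≤s z≤n
            either false true  = ≤-refl
            either false false = z≤n
    distribute : ∀ K P b c → 2 * (K * P * (b + c)) ≡ 2 * K * P * b + 2 * K * P * c
    distribute = solve-∀
    heavy₀ : #heavy₀ ^ (2 * K) * V K ^ M ≤ (2 ^ M′ * (2 * K + 1) ^ M) ^ (2 * K)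
    heavy₀ = exceeding-count k w (#zerosOn w) (#onesOn w) (#zerosOn+#onesOn w)
               (trans (allFuns-binomial (suc K) K m w) (cong (λ z → 2 ^ M′ * z ^ M) (sum k)))
      where sum : ∀ k → suc (2 + k) + (2 + k) ≡ 2 * (2 + k) + 1
            sum = solve-∀
    heavy₁ : #heavy₁ ^ (2 * K) * V K ^ M ≤ (2 ^ M′ * (2 * K + 1) ^ M) ^ (2 * K)
    heavy₁ = exceeding-count k w (#onesOn w) (#zerosOn w) (λ g → trans (+-comm (#onesOn w g) (#zerosOn w g)) (#zerosOn+#onesOn w g))
               (trans (sumBy-cong (λ g → *-comm (suc K ^ #onesOn w g) (K ^ #zerosOn w g)) (allFuns m))
                      (trans (allFuns-binomial K (suc K) m w) (cong (λ z → 2 ^ M′ * z ^ M) (sum k))))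
      where sum : ∀ k → (2 + k) + suc (2 + k) ≡ 2 * (2 + k) + 1
            sum = solve-∀
    c₀-bound : c₀ ^ (2 * K) * U K ^ M ≤ (2 ^ (2 * K) * V K) ^ M
    c₀-bound = ≤-trans (*-monoˡ-≤ (U K ^ M) ([2K*2^N]^2K≤2^[2K*[2K+N]] K N))
                       (2^j*u^M≤w^M (U K) (W K) (2 * K * (2 * K + N)) M {{m^n≢0 (2 * K + 1) (2 * K)}} (U<W k) large)
    bound : ∀ c → c ^ (2 * K) * V K ^ M ≤ (2 ^ M′ * (2 * K + 1) ^ M) ^ (2 * K) → c₀ * c ≤ 2 ^ (M + M′)
    bound c c-bound = c₀*c≤2^[M+M′] (2 * K) (2 * K + 1) c₀ c M M′ (V K) {{V≢0}} c-bound c₀-bound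
      where V≢0 = m*n≢0 (suc K ^ (K + 2)) (K ^ k) {{m^n≢0 (suc K) (K + 2)}} {{m^n≢0 K k}}

  onPairs : ∀ {n} → (BVec n × BVec n → Bool) → Fun (n + n)
  onPairs {n} f v = f (splitAt n v)

  length-filterB-allPairs : ∀ n (s : BVec n × BVec n → Bool) → length (filterB s (allPairs n)) ≡ #ones (onPairs s)
  length-filterB-allPairs n s = trans (length-filterB s (allPairs n)) (sumBy-allPairs-splitAt n _)

  countB-filterB-allPairs : ∀ n (s p e : BVec n × BVec n → Bool) → (∀ a → p a ≡ not (e a)) →
    countB p (filterB s (allPairs n)) ≡ #zerosOn (onPairs s) (onPairs e)
  countB-filterB-allPairs n s p e p≡¬e =
    trans (countB-filterB s p (allPairs n))
          (trans (sumBy-cong (λ a → cong (λ b → 𝟙 (s a ∧ b)) (p≡¬e a)) (allPairs n)) (sumBy-allPairs-splitAt n _))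

  does-≟ : ∀ a b → does (a ≟ b) ≡ not (a xor b)
  does-≟ true  true  = refl
  does-≟ true  false = refl
  does-≟ false true  = refl
  does-≟ false false = refl

  eval-cong : {p q : Poly m} → p ≗ᶠ q → ∀ v → eval p v ≡ eval q v
  eval-cong p≗q v = xorSum-cong (λ mono → cong (_∧ monomial mono v) (p≗q mono)) (allVecs _)

  does⇒ : {P : Set} {P? : Dec P} → does P? ≡ true → P
  does⇒ {P? = yes p} _ = p

  ∧-true⇒ : ∀ {a b} → a ∧ b ≡ true → a ≡ true × b ≡ true
  ∧-true⇒ {true} {true} _ = refl , refl

  balanced⇒ : ∀ K (w g : Fun m) → balanced K w g ≡ true →
    2 * K * #zerosOn w g ≤ (K + 2) * #ones w × 2 * K * #onesOn w g ≤ (K + 2) * #ones w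
  balanced⇒ K w g bal with ∧-true⇒ {not (exceeds K w (#zerosOn w g))} {not (exceeds K w (#onesOn w g))} bal
  ... | zeros , ones = does⇒ {P? = 2 * K * #zerosOn w g ≤? (K + 2) * #ones w} (trans (sym (not-involutive _)) zeros)
                     , does⇒ {P? = 2 * K * #onesOn w g ≤? (K + 2) * #ones w} (trans (sym (not-involutive _)) ones)

  balanced-cong : ∀ K (w : Fun m) {g h : Fun m} → g ≗ᶠ h → balanced K w g ≡ balanced K w h
  balanced-cong {m} K w g≗h =
    cong₂ (λ z y → not (exceeds K w z) ∧ not (exceeds K w y))
          (sumBy-cong (λ v → cong (λ b → 𝟙 (w v ∧ not b)) (g≗h v)) (allVecs m))
          (sumBy-cong (λ v → cong (λ b → 𝟙 (w v ∧ b)) (g≗h v)) (allVecs m))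

  module Candidates {n : ℕ} (d : ℕ) (Φ Ψ : Poly n) (k : ℕ) where

    K = 2 + k

    indicatorS : Fun (n + n)
    indicatorS = onPairs (inS d Φ Ψ)

    errorAt : BoolFun n → Poly (n + n) → BVec n × BVec n → Bool
    errorAt H q (x , y) = H x y xor eval q (x ++ y)

    errorOf : BoolFun n → Poly (n + n) → Fun (n + n)
    errorOf H q = onPairs (errorAt H q)

    lowMonos : List (BVec (n + n))
    lowMonos = lowMonomials (n + n) (3 * d ∸ 1)

    lowPolys : List (Poly (n + n))
    lowPolys = polysOn lowMonos

    unbalanced : List (Fun (n + n))
    unbalanced = filterB (λ g → not (balanced K indicatorS g)) (allFuns (n + n))

    fromError : Poly (n + n) → Fun (n + n) → BoolFun n
    fromError q g x y = g (x ++ y) xor eval q (x ++ y)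

    candidates : List (BoolFun n)
    candidates = concatMap (λ q → map (fromError q) unbalanced) lowPolys

    length-candidates : length candidates ≡ 2 ^ length lowMonos * length unbalanced
    length-candidates = begin
      length candidates                                              ≡⟨ length≡sumBy-1 candidates ⟩
      ∑[ _ ∈ candidates ] 1                                          ≡⟨ sumBy-concatMap (λ _ → 1) _ lowPolys ⟩
      ∑[ q ∈ lowPolys ] ∑[ _ ∈ map (fromError q) unbalanced ] 1      ≡⟨ sumBy-cong (λ q → trans (sumBy-map (λ _ → 1) (fromError q) unbalanced) (sym (length≡sumBy-1 unbalanced))) lowPolys ⟩
      ∑[ _ ∈ lowPolys ] length unbalanced                            ≡⟨ sumBy-const (length unbalanced) lowPolys ⟩
      length unbalanced * length lowPolys                            ≡⟨ *-comm (length unbalanced) _ ⟩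
      length lowPolys * length unbalanced                            ≡⟨ cong (_* length unbalanced) (length-polysOn lowMonos) ⟩
      2 ^ length lowMonos * length unbalanced ∎
      where open ≡-Reasoning

    module _ (ε : ℚ) .{{_ : NonNegative ε}} (1≤εK : fromℕ 1 ℚ.≤ ε ℚ.* fromℕ K) (H : BoolFun n) where

      balanced⇒agreement : ∀ (Q′ : Poly (n + n)) q → q ≗ᶠ Q′ → balanced K indicatorS (errorOf H q) ≡ true →
        (p : BVec n × BVec n → Bool) → (∀ x y → p (x , y) ≡ does (H x y ≟ eval Q′ (x ++ y))) →
        ℚ._≤_ (ℚ.∣ toℚ (2 * countB p (filterB (inS d Φ Ψ) (allPairs n))) ℚ.- toℚ (length (filterB (inS d Φ Ψ) (allPairs n))) ∣)
              (toℚ 2 ℚ.* ε ℚ.* toℚ (length (filterB (inS d Φ Ψ) (allPairs n))))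
      balanced⇒agreement Q′ q q≗Q′ bal p p≡ =
        subst₂ (λ A M → ℚ._≤_ (ℚ.∣ toℚ (2 * A) ℚ.- toℚ M ∣) (toℚ 2 ℚ.* ε ℚ.* toℚ M))
          (sym (countB-filterB-allPairs n (inS d Φ Ψ) p (errorAt H q) p≡¬error))
          (sym (length-filterB-allPairs n (inS d Φ Ψ)))
          (∣2Z-M∣≤2εM ε (suc k) 1≤εK (#zerosOn indicatorS (errorOf H q)) (#onesOn indicatorS (errorOf H q)) (#ones indicatorS)
            (#zerosOn+#onesOn indicatorS (errorOf H q))
            (proj₁ (balanced⇒ K indicatorS (errorOf H q) bal)) (proj₂ (balanced⇒ K indicatorS (errorOf H q) bal)))
        where
        p≡¬error : ∀ a → p a ≡ not (errorAt H q a)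
        p≡¬error (x , y) =
          trans (p≡ x y) (trans (does-≟ (H x y) _) (cong (λ z → not (H x y xor z)) (sym (eval-cong q≗Q′ (x ++ y)))))

      balanced⇒hard : All (λ q → balanced K indicatorS (errorOf H q) ≡ true) lowPolys → Hard d Φ Ψ ε H
      balanced⇒hard all-balanced Q′ deg =
        let q , q∈ , q≗Q′ = polysOn-complete lowMonos Q′ (lowMonomials-complete (3 * d ∸ 1) Q′ deg)
        in balanced⇒agreement Q′ q q≗Q′ (All.lookup all-balanced q∈) _ (λ x y → refl)

      H≡fromError : ∀ q g → g ≗ᶠ errorOf H q → ∀ x y → H x y ≡ fromError q g x y
      H≡fromError q g g≗error x y = begin
        H x y                                  ≡⟨ sym (xor-cancelʳ (H x y) (eval q (x ++ y))) ⟩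
        errorAt H q (x , y) xor eval q (x ++ y) ≡⟨ cong (λ z → errorAt H q z xor eval q (x ++ y)) (sym (splitAt-++ n x y)) ⟩
        errorOf H q (x ++ y) xor eval q (x ++ y) ≡⟨ cong (_xor eval q (x ++ y)) (sym (g≗error (x ++ y))) ⟩
        fromError q g x y                      ∎
        where open ≡-Reasoning

      unbalanced⇒candidate : ∀ q → q ∈ lowPolys → ¬ balanced K indicatorS (errorOf H q) ≡ true →
                             Any (λ H′ → ∀ x y → H x y ≡ H′ x y) candidates
      unbalanced⇒candidate q q∈ unbal =
        let g , g∈ , g≗error = allFuns-complete (n + n) (errorOf H q)
            g-unbalanced = ∈-filterB⁺ _ (allFuns (n + n)) g∈
                             (cong not (trans (balanced-cong K indicatorS g≗error) (¬-true⇒false unbal)))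
        in lose (∈-concatMap⁺ _ lowPolys q∈ (∈-map⁺ (fromError q) g-unbalanced)) (H≡fromError q g g≗error)
        where
        ¬-true⇒false : ∀ {b} → ¬ b ≡ true → b ≡ false
        ¬-true⇒false {true}  b≢true = contradiction refl b≢true
        ¬-true⇒false {false} _      = refl

      nonHard⇒candidate : ¬ Hard d Φ Ψ ε H → Any (λ H′ → ∀ x y → H x y ≡ H′ x y) candidates
      nonHard⇒candidate ¬hard = decide (all? (λ q → balanced K indicatorS (errorOf H q) ≟ true) lowPolys)
        where
        decide : Dec (All (λ q → balanced K indicatorS (errorOf H q) ≡ true) lowPolys) →
                 Any (λ H′ → ∀ x y → H x y ≡ H′ x y) candidates
        decide (yes all-balanced) = contradiction (balanced⇒hard all-balanced) ¬hard
        decide (no ¬all-balanced) =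
          let q , q∈ , unbal = find (¬All⇒Any¬ (λ q → balanced K indicatorS (errorOf H q) ≟ true) lowPolys ¬all-balanced) in unbalanced⇒candidate q q∈ unbal

    K*length-candidates≤2^2^[n+n] : U K * (2 * K * (2 * K + length lowMonos)) ≤ #ones indicatorS →
                                    K * length candidates ≤ 2 ^ (2 ^ (n + n))
    K*length-candidates≤2^2^[n+n] large = begin
      K * length candidates                                     ≡⟨ cong (K *_) length-candidates ⟩
      K * (2 ^ length lowMonos * length unbalanced)             ≡⟨ sym (*-assoc K (2 ^ length lowMonos) (length unbalanced)) ⟩
      K * 2 ^ length lowMonos * length unbalanced               ≡⟨ cong (K * 2 ^ length lowMonos *_) (length-filterB _ (allFuns (n + n))) ⟩
      K * 2 ^ length lowMonos * ∑[ g ∈ allFuns (n + n) ] 𝟙 (not (balanced K indicatorS g))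
                                                                ≤⟨ unbalanced-count k indicatorS (length lowMonos) large ⟩
      2 ^ (2 ^ (n + n))                                         ∎
      where open ≤-Reasoning

  threshold : ℕ → ℕ → ℕ
  threshold d K = 2 * D + c * (2 * D + 1) ^ D
    where
    D = 3 * d ∸ 1
    c = U K * (2 * K) * (2 * K + (2 * d + 1) ^ D)

  [2[d+m]+1]≤[2d+1][m+1] : ∀ d m → 1 ≤ d → suc ((d + m) + (d + m)) ≤ (2 * d + 1) * (m + 1)
  [2[d+m]+1]≤[2d+1][m+1] (suc d) m _ = subst (suc ((suc d + m) + (suc d + m)) ≤_) (sym (expand d m)) (m≤m+n _ (2 * d * m + m))
    where expand : ∀ d m → (2 * suc d + 1) * (m + 1) ≡ suc ((suc d + m) + (suc d + m)) + (2 * d * m + m)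
          expand = solve-∀

  -- The polynomially many low-degree monomials are swamped by |S| ≥ 4^m.
  large-S : ∀ d K m → 1 ≤ d → threshold d K ≤ m → let D = 3 * d ∸ 1 in
    ∀ N M → N ≤ suc ((d + m) + (d + m)) ^ D → 4 ^ m ≤ M → U K * (2 * K * (2 * K + N)) ≤ M
  large-S d K m 1≤d m-large N M N≤ 4^m≤M = begin
    U K * (2 * K * (2 * K + N))               ≤⟨ *-monoʳ-≤ (U K) (*-monoʳ-≤ (2 * K) (+-monoʳ-≤ (2 * K) N≤aP)) ⟩
    U K * (2 * K * (2 * K + a * P))           ≤⟨ *-monoʳ-≤ (U K) (*-monoʳ-≤ (2 * K) (+-monoˡ-≤ (a * P) (m≤m*n (2 * K) P {{P≢0}}))) ⟩
    U K * (2 * K * (2 * K * P + a * P))       ≡⟨ factor (U K) (2 * K) a P ⟩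
    U K * (2 * K) * (2 * K + a) * P           ≤⟨ c*[m+1]^D≤4^m (U K * (2 * K) * (2 * K + a)) D m m-large ⟩
    4 ^ m                                     ≤⟨ 4^m≤M ⟩
    M                                         ∎
    where
    open ≤-Reasoning
    D = 3 * d ∸ 1
    a = (2 * d + 1) ^ D
    P = (m + 1) ^ D
    P≢0 = m^n≢0 (m + 1) D {{subst NonZero (+-comm 1 m) _}}
    N≤aP : N ≤ a * P
    N≤aP = ≤-trans N≤ (≤-trans (^-monoˡ-≤ D ([2[d+m]+1]≤[2d+1][m+1] d m 1≤d)) (≤-reflexive (^-distribʳ-* (2 * d + 1) (m + 1) D)))
    factor : ∀ u t a p → u * (t * (t * p + a * p)) ≡ u * t * (t + a) * p
    factor = solve-∀

  NonHardEnumeration : ℕ → ℚ → ℕ → Set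
  NonHardEnumeration d ε n = ∀ (Φ Ψ : Poly n) → DSimple d Φ → DSimple d Ψ →
    Σ (List (BoolFun n)) λ L →
      (∀ (H : BoolFun n) → ¬ Hard d Φ Ψ ε H → Any (λ H′ → ∀ x y → H x y ≡ H′ x y) L)
      × ℚ._≤_ (toℚ (length L)) (ε ℚ.* toℚ (2 ^ (2 ^ (n + n))))

  nonHardEnumeration : ∀ j k m (ε : ℚ) .{{_ : NonNegative ε}} → fromℕ 1 ℚ.≤ ε ℚ.* fromℕ (2 + k) →
    threshold (2 ^ j) (2 + k) ≤ m → NonHardEnumeration (2 ^ j) ε (2 ^ j + m)
  nonHardEnumeration j k m ε 1≤εK m-large Φ Ψ simpleΦ simpleΨ =
    candidates , nonHard⇒candidate ε 1≤εK , ≤⇒≤ε* ε (suc k) 1≤εK {length candidates} {2 ^ (2 ^ (n + n))} (K*length-candidates≤2^2^[n+n] large)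
    where
    open Candidates (2 ^ j) Φ Ψ k
    n = 2 ^ j + m
    large : U K * (2 * K * (2 * K + length lowMonos)) ≤ #ones indicatorS
    large = large-S (2 ^ j) K m (m^n>0 2 j) m-large (length lowMonos) (#ones indicatorS)
              (length-lowMonomials (n + n) (3 * 2 ^ j ∸ 1))
              (subst (4 ^ m ≤_) (length-filterB-allPairs n (inS (2 ^ j) Φ Ψ)) (4^m≤length-S j m Φ Ψ simpleΦ simpleΨ))

  nonHardEnumeration-≥ : ∀ j k (ε : ℚ) .{{_ : NonNegative ε}} → fromℕ 1 ℚ.≤ ε ℚ.* fromℕ (2 + k) →
    ∀ n → 2 ^ j + threshold (2 ^ j) (2 + k) ≤ n → NonHardEnumeration (2 ^ j) ε n
  nonHardEnumeration-≥ j k ε 1≤εK n n≥ =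
    let o , t+o≡n = m≤n⇒∃[o]m+o≡n n≥
    in subst (NonHardEnumeration (2 ^ j) ε) (trans (sym (+-assoc (2 ^ j) t o)) t+o≡n)
             (nonHardEnumeration j k (t + o) ε 1≤εK (m≤m+n t o))
    where
    t : ℕ
    t = threshold (2 ^ j) (2 + k)

open Lemmas using (NonHardEnumeration; threshold; nonHardEnumeration-≥)
open RationalBounds using (1≤ε*[1+↧ε])

open import Data.Nat using (ℕ; _+_; _^_; _≤_)
open import Data.List using (List; length)
open import Data.List.Relation.Unary.Any using (Any)
open import Data.Product using (Σ; ∃; _×_; _,_)
open import Relation.Nullary using (¬_)
open import Relation.Binary.PropositionalEquality using (_≡_; refl)
open import Data.Rational using (ℚ; Positive; _*_)
import Data.Rational as Q
open import Data.Rational.Properties using (pos⇒nonNeg)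

lemma3p9 : (d : ℕ) → PowerOf2 d →
    (ε : ℚ) → Positive ε →
    ∃ λ (n₀ : ℕ) → ∀ (n : ℕ) → n₀ ≤ n →
    ∀ (Φ₁ Φ₂ Ψ₁ Ψ₂ : Poly n) →
    DSimple d Φ₁ → DSimple d Φ₂ → DSimple d Ψ₁ → DSimple d Ψ₂ →
    -- #{H : {0,1}^{2n} → {0,1} not ε-hard} ≤ ε · 2^(2^(2n)):
    -- all non-ε-hard H occur (up to pointwise equality) in a list L
    -- of length ≤ ε · 2^(2^(2n)).
    Σ (List (BoolFun n)) λ L →
      (∀ (H : BoolFun n) → ¬ Hard d Φ₁ Ψ₁ ε H →
        Any (λ H' → ∀ x y → H x y ≡ H' x y) L)
      × (toℚ (length L) Q.≤ ε * toℚ (2 ^ (2 ^ (n + n))))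
lemma3p9 d (j , refl) ε ε>0 =
  2 ^ j + threshold (2 ^ j) (2 + k) ,
  -- ε-hardness involves only Φ₁ and Ψ₁.
  λ n n≥n₀ Φ₁ _ Ψ₁ _ simpleΦ₁ _ simpleΨ₁ _ → enumerate n n≥n₀ Φ₁ Ψ₁ simpleΦ₁ simpleΨ₁
  where
  k : ℕ
  k = Q.ℚ.denominator-1 ε
  enumerate : ∀ n → 2 ^ j + threshold (2 ^ j) (2 + k) ≤ n → NonHardEnumeration (2 ^ j) ε n
  enumerate = nonHardEnumeration-≥ j k ε {{pos⇒nonNeg ε {{ε>0}}}} (1≤ε*[1+↧ε] ε ε>0)
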